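{- For every $p\in\mathcal P^{\circ\bullet}_{2,\mathrm{nb}}$ and every sector $S$ of $p$, the associated bracket satisfies $B(p,S)\in\langle p\rangle$.
   Context: Two-colored partitions: points in a lower and an upper row (each ordered left to right), colored $\circ$ or $\bullet$, partitioned into blocks; pair partition: all blocks of size two. Tensor product (juxtaposition), involution $p^*$ (swap rows), composition $pq$ (defined when the upper row of $p$ and lower row of $q$ match in length and coloring; identify them; $pq$ has lower row of $p$, upper row of $q$, blocks given by connectivity through blocks of $p$ and $q$). A category is a set closed under these operations containing the identity partitions for both colors and the one-block partitions with empty upper row and lower row $\bullet\circ$, resp. $\circ\bullet$; $\langle\mathcal G\rangle$ is the smallest category containing $\mathcal G$. Cyclic order: lower row left to right, then upper row right to left. Normalized color: color for lower points, inverse color for upper points; $\sigma_p(S)$ = #normalized $\bullet$ minus #normalized $\circ$ in $S$. $\mathcal P^{\circ\bullet}_{2,\mathrm{nb}}$: pair partitions all of whose blocks have $\sigma_p=0$. For a proper subset $S$ that is an interval of the cyclic order, $\partial S$ is its first and last point and $\mathrm{int}(S)=S\setminus\partial S$; $S$ is a sector if $\partial S$ is a block; two blocks $B\ne B'$ cross if there are $\alpha,\beta\in B$, $\gamma,\delta\in B'$ occurring in cyclic order as $(\alpha,\gamma,\beta,\delta)$. A bracket is a $p\in\mathcal P^{\circ\bullet}_{2,\mathrm{nb}}$ with $p=p^*$, $pp=p$, whose lower row is a sector of $p$. For sectors $S$ of $p$ and $S'$ of $p'$ (both in $\mathcal P^{\circ\bullet}_{2,\mathrm{nb}}$), number the points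 of $\mathrm{int}(S)$, $\mathrm{int}(S')$ along the cyclic order; $(p,S)$ and $(p',S')$ are equivalent if $S,S'$ have equal size, the same normalized colors occur in the same order, for each $i$ the $i$-th point of $S$ lies in a block crossing $\partial S$ iff the $i$-th point of $S'$ lies in a block crossing $\partial S'$, and for all $i,j$ the $i$-th and $j$-th points of $S$ form a block iff the $i$-th and $j$-th points of $S'$ do. $B(p,S)$ is the unique bracket $q$ with lower row $M$ such that $(p,S)$ and $(q,M)$ are equivalent. -}

module Defs where

open import Level using (0ℓ)
open import Data.Nat using (ℕ; zero; suc; _+_; _∸_; _<_; _%_; z≤n; s≤s)
open import Data.Nat.Properties using (m<m+n)
open import Data.Nat.DivMod using (m%n<n)
open import Data.Fin using (Fin; toℕ; fromℕ<; splitAt; _↑ˡ_; _↑ʳ_; opposite)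
open import Data.Vec using (Vec; []; _∷_; _++_; lookup)
open import Data.Sum using (_⊎_; inj₁; inj₂; swap)
open import Data.Sum.Relation.Binary.Pointwise using (Pointwise; ⊎-isEquivalence)
open import Data.Product using (Σ; ∃; _×_; _,_)
open import Data.Unit using (⊤; tt)
open import Data.List using (List; []; _∷_; foldr)
open import Data.Integer using (ℤ; +_; -[1+_]; 0ℤ) renaming (_+_ to _+ℤ_)
open import Relation.Nullary using (¬_)
open import Relation.Binary using (Rel; IsEquivalence)
open import Relation.Binary.PropositionalEquality using (_≡_; _≢_; isEquivalence)
open import Relation.Binary.Construct.Closure.Equivalence using (EqClosure)
import Relation.Binary.Construct.Closure.Equivalence as EqC
import Relation.Binary.Construct.On as On
open import Function.Bundles using (_⇔_)

data Col : Set where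
  white black : Col

inv : Col → Col
inv white = black
inv black = white

-- points of a partition with k lower and l upper points:
-- inj₁ i = i-th lower point, inj₂ j = j-th upper point (left to right)
Pt : ℕ → ℕ → Set
Pt k l = Fin k ⊎ Fin l

-- A two-coloured partition with lower row coloured lo and upper row
-- coloured up, given by the equivalence relation "lies in the same block".
record Part {k l : ℕ} (lo : Vec Col k) (up : Vec Col l) : Set₁ where
  field
    rel   : Rel (Pt k l) 0ℓ
    equiv : IsEquivalence rel
open Part public

_≈ₚ_ : ∀ {k l} {lo : Vec Col k} {up : Vec Col l} → Part lo up → Part lo up → Set
p ≈ₚ q = ∀ x y → rel p x y ⇔ rel q x y

trivRel : ∀ {A : Set} → Rel A 0ℓ
trivRel _ _ = ⊤

trivEquiv : ∀ {A : Set} → IsEquivalence (trivRel {A})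
trivEquiv = record { refl = tt ; sym = λ _ → tt ; trans = λ _ _ → tt }

idPart : (c : Col) → Part (c ∷ []) (c ∷ [])
idPart c = record { rel = trivRel ; equiv = trivEquiv }

pairPart : (c d : Col) → Part (c ∷ d ∷ []) []
pairPart c d = record { rel = trivRel ; equiv = trivEquiv }

_* : ∀ {k l} {lo : Vec Col k} {up : Vec Col l} → Part lo up → Part up lo
p * = record { rel = λ x y → rel p (swap x) (swap y)
             ; equiv = On.isEquivalence swap (equiv p) }

splitPt : ∀ {k k' l l'} → Pt (k + k') (l + l') → Pt k l ⊎ Pt k' l'
splitPt {k} (inj₁ i) with splitAt k i
... | inj₁ a = inj₁ (inj₁ a)
... | inj₂ b = inj₂ (inj₁ b)
splitPt {k} {k'} {l} (inj₂ j) with splitAt l j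
... | inj₁ a = inj₁ (inj₂ a)
... | inj₂ b = inj₂ (inj₂ b)

_⊗_ : ∀ {k l k' l'} {lo : Vec Col k} {up : Vec Col l}
        {lo' : Vec Col k'} {up' : Vec Col l'} →
      Part lo up → Part lo' up' → Part (lo ++ lo') (up ++ up')
p ⊗ q = record
  { rel   = λ x y → Pointwise (rel p) (rel q) (splitPt x) (splitPt y)
  ; equiv = On.isEquivalence splitPt (⊎-isEquivalence (equiv p) (equiv q)) }

-- composition: p has lower row lo, upper row mid; q has lower row mid,
-- upper row hi.  Three-row points: lower of p, middle, upper of q.
Pt3 : ℕ → ℕ → ℕ → Set
Pt3 k l m = Fin k ⊎ (Fin l ⊎ Fin m)

embP : ∀ {k l m} → Pt k l → Pt3 k l m
embP (inj₁ i) = inj₁ i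
embP (inj₂ j) = inj₂ (inj₁ j)

embQ : ∀ {k l m} → Pt l m → Pt3 k l m
embQ (inj₁ j) = inj₂ (inj₁ j)
embQ (inj₂ h) = inj₂ (inj₂ h)

outer : ∀ {k l m} → Pt k m → Pt3 k l m
outer (inj₁ i) = inj₁ i
outer (inj₂ h) = inj₂ (inj₂ h)

data Edge {k l m} {lo : Vec Col k} {mid : Vec Col l} {hi : Vec Col m}
          (p : Part lo mid) (q : Part mid hi) : Rel (Pt3 k l m) 0ℓ where
  pEdge : ∀ {a b} → rel p a b → Edge p q (embP a) (embP b)
  qEdge : ∀ {a b} → rel q a b → Edge p q (embQ a) (embQ b)

-- pq : lower row of p, upper row of q, blocks = connectivity
_·_ : ∀ {k l m} {lo : Vec Col k} {mid : Vec Col l} {hi : Vec Col m} →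
      Part lo mid → Part mid hi → Part lo hi
_·_ {k} {l} {m} p q = record
  { rel   = λ x y → EqClosure (Edge p q) (outer {k} {l} {m} x) (outer y)
  ; equiv = On.isEquivalence outer (EqC.isEquivalence (Edge p q)) }

data ⟨_⟩ {k₀ l₀} {lo₀ : Vec Col k₀} {up₀ : Vec Col l₀} (p₀ : Part lo₀ up₀) :
         ∀ {k l} {lo : Vec Col k} {up : Vec Col l} → Part lo up → Set₁ where
  gen    : ⟨ p₀ ⟩ p₀
  idW    : ⟨ p₀ ⟩ (idPart white)
  idB    : ⟨ p₀ ⟩ (idPart black)
  pairBW : ⟨ p₀ ⟩ (pairPart black white)
  pairWB : ⟨ p₀ ⟩ (pairPart white black)
  tens   : ∀ {k l k' l'} {lo : Vec Col k} {up : Vec Col l}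
             {lo' : Vec Col k'} {up' : Vec Col l'}
             {p : Part lo up} {q : Part lo' up'} →
           ⟨ p₀ ⟩ p → ⟨ p₀ ⟩ q → ⟨ p₀ ⟩ (p ⊗ q)
  invol  : ∀ {k l} {lo : Vec Col k} {up : Vec Col l} {p : Part lo up} →
           ⟨ p₀ ⟩ p → ⟨ p₀ ⟩ (p *)
  comp   : ∀ {k l m} {lo : Vec Col k} {mid : Vec Col l} {hi : Vec Col m}
             {p : Part lo mid} {q : Part mid hi} →
           ⟨ p₀ ⟩ p → ⟨ p₀ ⟩ q → ⟨ p₀ ⟩ (p · q)
  resp   : ∀ {k l} {lo : Vec Col k} {up : Vec Col l} {p q : Part lo up} →
           p ≈ₚ q → ⟨ p₀ ⟩ p → ⟨ p₀ ⟩ q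

ncol : ∀ {k l} → Vec Col k → Vec Col l → Pt k l → Col
ncol lo up (inj₁ i) = lookup lo i
ncol lo up (inj₂ j) = inv (lookup up j)

val : Col → ℤ
val black = + 1
val white = -[1+ 0 ]

-- σ_p(S) for a finite set S of points given as a duplicate-free list
σ : ∀ {k l} → Vec Col k → Vec Col l → List (Pt k l) → ℤ
σ lo up = foldr (λ x s → val (ncol lo up x) +ℤ s) 0ℤ

IsBlock2 : ∀ {k l} {lo : Vec Col k} {up : Vec Col l} →
           Part lo up → Pt k l → Pt k l → Set
IsBlock2 p x y = ∀ z → rel p x z ⇔ (z ≡ x ⊎ z ≡ y)

IsPairPart : ∀ {k l} {lo : Vec Col k} {up : Vec Col l} → Part lo up → Set
IsPairPart p = ∀ x → ∃ λ y → y ≢ x × IsBlock2 p x y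

P2nb : ∀ {k l} {lo : Vec Col k} {up : Vec Col l} → Part lo up → Set
P2nb {lo = lo} {up} p =
  IsPairPart p × (∀ x y → x ≢ y → IsBlock2 p x y → σ lo up (x ∷ y ∷ []) ≡ 0ℤ)

-- Cyclic order: lower row left to right, then upper row right to left.

atPos : ∀ {k l} → Fin (k + l) → Pt k l
atPos {k} r with splitAt k r
... | inj₁ i = inj₁ i
... | inj₂ j = inj₂ (opposite j)

posℕ : ∀ {k l} → Pt k l → ℕ
posℕ {k} {l} (inj₁ i) = toℕ i
posℕ {k} {l} (inj₂ j) = k + toℕ (opposite j)

CycOrd : ∀ {k l} → Pt k l → Pt k l → Pt k l → Pt k l → Set
CycOrd a b c d = Lin (posℕ a) (posℕ b) (posℕ c) (posℕ d)
               ⊎ Lin (posℕ b) (posℕ c) (posℕ d) (posℕ a)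
               ⊎ Lin (posℕ c) (posℕ d) (posℕ a) (posℕ b)
               ⊎ Lin (posℕ d) (posℕ a) (posℕ b) (posℕ c)
  where
  Lin : ℕ → ℕ → ℕ → ℕ → Set
  Lin w x y z = w < x × x < y × y < z

Crosses : ∀ {k l} {lo : Vec Col k} {up : Vec Col l} →
          Part lo up → Pt k l → Pt k l → Set
Crosses p x y = ¬ rel p x y ×
  (∃ λ α → ∃ λ β → ∃ λ γ → ∃ λ δ →
     rel p x α × rel p x β × rel p y γ × rel p y δ × CycOrd α γ β δ)

shift : ∀ {n} → Fin n → ℕ → Fin n
shift {suc n} a i = fromℕ< (m%n<n (toℕ a + i) (suc n))

-- a nonempty proper subset of the n points that is an interval of the
-- cyclic order: the points at positions start, start+1, …, start+len-1
-- (mod n).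
record Interval (n : ℕ) : Set where
  field
    start : Fin n
    len   : ℕ
    0<len : 0 < len
    len<n : len < n
open Interval public

ptAt : ∀ {k l} → Interval (k + l) → ℕ → Pt k l
ptAt S i = atPos (shift (start S) i)

firstPt lastPt : ∀ {k l} → Interval (k + l) → Pt k l
firstPt S = ptAt S 0
lastPt  S = ptAt S (len S ∸ 1)

IsSector : ∀ {k l} {lo : Vec Col k} {up : Vec Col l} →
           Part lo up → Interval (k + l) → Set
IsSector p S = IsBlock2 p (firstPt S) (lastPt S)

-- i-th point of int(S), i = 0 … len-3
intPt : ∀ {k l} → Interval (k + l) → ℕ → Pt k l
intPt S i = ptAt S (suc i)

record SecEquiv {k l k' l'} {lo : Vec Col k} {up : Vec Col l}
                {lo' : Vec Col k'} {up' : Vec Col l'}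
                (p : Part lo up) (S : Interval (k + l))
                (p' : Part lo' up') (S' : Interval (k' + l')) : Set where
  field
    sameSize  : len S ≡ len S'
    sameCols  : ∀ i → i < len S →
                ncol lo up (ptAt S i) ≡ ncol lo' up' (ptAt S' i)
    sameCross : ∀ i → 2 + i < len S →
                Crosses p (intPt S i) (firstPt S) ⇔ Crosses p' (intPt S' i) (firstPt S')
    sameBlock : ∀ i j → 2 + i < len S → 2 + j < len S →
                IsBlock2 p (intPt S i) (intPt S j) ⇔ IsBlock2 p' (intPt S' i) (intPt S' j)

lowerRow : (m : ℕ) → Interval (suc m + suc m)
lowerRow m = record { start = Fin.zero ; len = suc m ; 0<len = s≤s z≤n
                    ; len<n = m<m+n (suc m) (s≤s z≤n) }
  where import Data.Fin as Fin

-- q is a bracket (its lower row M is nonempty, since it is a sector)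
IsBracket : ∀ {m} {M : Vec Col (suc m)} → Part M M → Set
IsBracket {m} q = P2nb q × (q ≈ₚ (q *)) × ((q · q) ≈ₚ q) × IsSector q (lowerRow m)

module Submission where

-- Number the N points of p cyclically from the start of S, so that S
-- is {0, …, L-1}; the pairing of p becomes a fixed-point-free involution ρ of
-- {0, …, N-1} with ρ 0 = L-1, inverting the normalised colours.
--  * Rotation: with identities and caps, a point can be moved between the ends
--    of the lower and the upper row inside ⟨ p ⟩ (RotateLeft, RotateRight).
--    Iterating yields r ∈ ⟨ p ⟩ whose lower row is S and whose blocks are the
--    pairs {d , ρ d} of cyclic positions (RotatedCopies).
--  * The bracket of ρ: Br pairs two points of a row in columns i and ρ i when
--    ρ i < L, and otherwise joins column i of the lower and the upper row.  It
--    is a bracket, its crossing and block data on the lower row are read off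
--    from ρ, hence (p,S) ~ (Br , lower row); and r r* = Br, so Br ∈ ⟨ p ⟩.
--  * Uniqueness: for a bracket q with (p,S) ~ (q , lower row), the sector, the
--    crossing and the block data, together with q = q* and q q = q, force the
--    partner of every point of q to be its partner in Br; so q = Br ∈ ⟨ p ⟩.

open import Defs
open import Level using (0ℓ)
open import Data.Nat as ℕ using (ℕ; zero; suc; _+_; _∸_; _<_; _≤_; _⊓_; _%_; z≤n; s≤s)
import Data.Nat.Properties as NP
open import Data.Nat.DivMod using (m%n<n; m<n⇒m%n≡m; [m+n]%n≡m%n; n%n≡0; %-distribˡ-+; m%n%n≡m%n)
open import Data.Fin as F using (Fin; zero; suc; toℕ; fromℕ<; splitAt; _↑ˡ_; _↑ʳ_; opposite; inject₁; fromℕ)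
import Data.Fin.Properties as FP
open import Data.Vec using (Vec; []; _∷_; _++_; lookup; _∷ʳ_; initLast; tabulate)
import Data.Vec.Properties as VP
open import Data.Sum using (_⊎_; inj₁; inj₂; swap; [_,_]′)
import Data.Sum as Sum
import Data.Sum.Properties as SP
open import Data.Sum.Relation.Binary.Pointwise using (Pointwise; ⊎-isEquivalence)
import Data.Sum.Relation.Binary.Pointwise as SumPW
open import Data.Maybe using (Maybe; just; nothing; maybe)
import Data.Maybe as Maybe
import Data.Maybe.Properties as MaybeP
import Data.Maybe.Relation.Binary.Pointwise as MaybePW
open import Data.Product using (Σ; ∃; _×_; _,_; proj₁; proj₂)
open import Data.Unit using (tt)
open import Data.Empty using (⊥-elim)
open import Data.Integer using (0ℤ) renaming (_+_ to _+ℤ_)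
open import Data.List using (_∷_; [])
open import Relation.Nullary using (¬_; yes; no)
open import Relation.Binary using (Rel; IsEquivalence)
open import Relation.Binary.PropositionalEquality hiding (resp)
open import Relation.Binary.Construct.Closure.Equivalence using (EqClosure)
import Relation.Binary.Construct.Closure.Equivalence as EqC
open import Relation.Binary.Construct.Closure.ReflexiveTransitive using (ε; _◅_; _◅◅_)
open import Relation.Binary.Construct.Closure.Symmetric using (fwd)
open import Function using (_∘_)
open import Function.Bundles using (_⇔_; mk⇔; Equivalence)
open Equivalence using (to; from)
import Function.Properties.Equivalence as ⇔

⇔-cong₂ : ∀ {A : Set} (R : A → A → Set) {a a' b b'} → a ≡ a' → b ≡ b' → R a b ⇔ R a' b'
⇔-cong₂ R refl refl = ⇔.refl

inv-involutive : ∀ c → inv (inv c) ≡ c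
inv-involutive white = refl
inv-involutive black = refl

≈ₚ-sym : ∀ {k l} {lo : Vec Col k} {up : Vec Col l} {p q : Part lo up} → p ≈ₚ q → q ≈ₚ p
≈ₚ-sym e x y = ⇔.sym (e x y)

rel-≡ : ∀ {k l} {lo : Vec Col k} {up : Vec Col l} (p : Part lo up) {a b} → a ≡ b → rel p a b
rel-≡ p refl = IsEquivalence.refl (equiv p)

byLabel : ∀ {k l} {lo : Vec Col k} {up : Vec Col l} {A : Set} → (Pt k l → A) → Part lo up
byLabel g = record { rel = λ a b → g a ≡ g b ; equiv = record { refl = refl ; sym = sym ; trans = trans } }

module Composition {k l m} {lo : Vec Col k} {mid : Vec Col l} {hi : Vec Col m}
                   (p : Part lo mid) (q : Part mid hi) where

  Path : Pt3 k l m → Pt3 k l m → Set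
  Path = EqClosure (Edge p q)

  viaP : ∀ {a b} → rel p a b → Path (embP a) (embP b)
  viaP r = fwd (pEdge r) ◅ ε

  viaQ : ∀ {a b} → rel q a b → Path (embQ a) (embQ b)
  viaQ r = fwd (qEdge r) ◅ ε

  reverse : ∀ {a b} → Path a b → Path b a
  reverse = EqC.symmetric (Edge p q)

  invariant : ∀ {A : Set} {E : Rel A 0ℓ} → IsEquivalence E → (f : Pt3 k l m → A) →
              (∀ a b → rel p a b → E (f (embP a)) (f (embP b))) →
              (∀ a b → rel q a b → E (f (embQ a)) (f (embQ b))) →
              ∀ x y → rel (p · q) x y → E (f (outer x)) (f (outer y))
  invariant {E = E} eq f onP onQ x y c = EqC.gfold eq f edge c
    where
    edge : ∀ {u v} → Edge p q u v → E (f u) (f v)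
    edge (pEdge r) = onP _ _ r
    edge (qEdge r) = onQ _ _ r

pointwise-map : ∀ {A B : Set} (g : A → B) u v →
                MaybePW.Pointwise (λ a b → g a ≡ g b) u v ⇔ (Maybe.map g u ≡ Maybe.map g v)
pointwise-map g u v = mk⇔ fw (bw u v)
  where
  fw : ∀ {u v} → MaybePW.Pointwise (λ a b → g a ≡ g b) u v → Maybe.map g u ≡ Maybe.map g v
  fw (MaybePW.just e) = cong just e
  fw MaybePW.nothing = refl
  bw : ∀ u v → Maybe.map g u ≡ Maybe.map g v → MaybePW.Pointwise (λ a b → g a ≡ g b) u v
  bw (just a) (just b) e = MaybePW.just (MaybeP.just-injective e)
  bw nothing nothing _ = MaybePW.nothing
  bw (just _) nothing ()
  bw nothing (just _) ()

dropFirst : ∀ {k l} → Pt (suc k) (suc l) → Maybe (Pt k l)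
dropFirst (inj₁ zero) = nothing
dropFirst (inj₁ (suc i)) = just (inj₁ i)
dropFirst (inj₂ zero) = nothing
dropFirst (inj₂ (suc j)) = just (inj₂ j)

id⊗-rel : ∀ {k l} {lo : Vec Col k} {up : Vec Col l} (d : Col) (p : Part lo up) x y →
          rel (idPart d ⊗ p) x y ⇔ MaybePW.Pointwise (rel p) (dropFirst x) (dropFirst y)
id⊗-rel d p x y = mk⇔ (fw x y) (bw x y)
  where
  fw : ∀ x y → rel (idPart d ⊗ p) x y → MaybePW.Pointwise (rel p) (dropFirst x) (dropFirst y)
  fw (inj₁ zero) (inj₁ zero) _ = MaybePW.nothing
  fw (inj₁ zero) (inj₂ zero) _ = MaybePW.nothing
  fw (inj₂ zero) (inj₁ zero) _ = MaybePW.nothing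
  fw (inj₂ zero) (inj₂ zero) _ = MaybePW.nothing
  fw (inj₁ (suc i)) (inj₁ (suc j)) (SumPW.inj₂ r) = MaybePW.just r
  fw (inj₁ (suc i)) (inj₂ (suc j)) (SumPW.inj₂ r) = MaybePW.just r
  fw (inj₂ (suc i)) (inj₁ (suc j)) (SumPW.inj₂ r) = MaybePW.just r
  fw (inj₂ (suc i)) (inj₂ (suc j)) (SumPW.inj₂ r) = MaybePW.just r
  fw (inj₁ zero) (inj₁ (suc j)) ()
  fw (inj₁ zero) (inj₂ (suc j)) ()
  fw (inj₂ zero) (inj₁ (suc j)) ()
  fw (inj₂ zero) (inj₂ (suc j)) ()
  fw (inj₁ (suc i)) (inj₁ zero) ()
  fw (inj₁ (suc i)) (inj₂ zero) ()
  fw (inj₂ (suc i)) (inj₁ zero) ()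
  fw (inj₂ (suc i)) (inj₂ zero) ()
  bw : ∀ x y → MaybePW.Pointwise (rel p) (dropFirst x) (dropFirst y) → rel (idPart d ⊗ p) x y
  bw (inj₁ zero) (inj₁ zero) _ = SumPW.inj₁ tt
  bw (inj₁ zero) (inj₂ zero) _ = SumPW.inj₁ tt
  bw (inj₂ zero) (inj₁ zero) _ = SumPW.inj₁ tt
  bw (inj₂ zero) (inj₂ zero) _ = SumPW.inj₁ tt
  bw (inj₁ (suc i)) (inj₁ (suc j)) (MaybePW.just r) = SumPW.inj₂ r
  bw (inj₁ (suc i)) (inj₂ (suc j)) (MaybePW.just r) = SumPW.inj₂ r
  bw (inj₂ (suc i)) (inj₁ (suc j)) (MaybePW.just r) = SumPW.inj₂ r
  bw (inj₂ (suc i)) (inj₂ (suc j)) (MaybePW.just r) = SumPW.inj₂ r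

id⊗byLabel : ∀ {k l} {lo : Vec Col k} {up : Vec Col l} {A B : Set} (d : Col)
             (g : Pt k l → A) (g⁺ : Pt (suc k) (suc l) → B) (enc : Maybe A → B) →
             (∀ u v → enc u ≡ enc v → u ≡ v) →
             (∀ x → g⁺ x ≡ enc (Maybe.map g (dropFirst x))) →
             (idPart d ⊗ byLabel {lo = lo} {up} g) ≈ₚ byLabel {lo = d ∷ lo} {d ∷ up} g⁺
id⊗byLabel {lo = lo} {up} d g g⁺ enc enc-inj g⁺-enc x y =
  ⇔.trans (id⊗-rel d (byLabel {lo = lo} {up} g) x y) (⇔.trans (pointwise-map g (dropFirst x) (dropFirst y))
    (mk⇔ (λ e → trans (g⁺-enc x) (trans (cong enc e) (sym (g⁺-enc y))))
         (λ e → enc-inj _ _ (trans (sym (g⁺-enc x)) (trans e (g⁺-enc y))))))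

shiftFin : ∀ {k} → Maybe (Fin k) → Fin (suc k)
shiftFin = maybe suc zero

shiftFin-injective : ∀ {k} (u v : Maybe (Fin k)) → shiftFin u ≡ shiftFin v → u ≡ v
shiftFin-injective (just i) (just j) e = cong just (FP.suc-injective e)
shiftFin-injective nothing nothing _ = refl
shiftFin-injective (just _) nothing ()
shiftFin-injective nothing (just _) ()

shiftℕ : Maybe ℕ → ℕ
shiftℕ = maybe suc 0

shiftℕ-injective : ∀ (u v : Maybe ℕ) → shiftℕ u ≡ shiftℕ v → u ≡ v
shiftℕ-injective (just i) (just j) e = cong just (NP.suc-injective e)
shiftℕ-injective nothing nothing _ = refl
shiftℕ-injective (just _) nothing ()
shiftℕ-injective nothing (just _) ()

dropCap : ∀ {k l} → Pt k (suc (suc l)) → Maybe (Pt k l)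
dropCap (inj₁ i) = just (inj₁ i)
dropCap (inj₂ zero) = nothing
dropCap (inj₂ (suc zero)) = nothing
dropCap (inj₂ (suc (suc j))) = just (inj₂ j)

cap⊗-rel : ∀ {k l} {lo : Vec Col k} {up : Vec Col l} (c d : Col) (p : Part lo up) x y →
           rel (((pairPart c d) *) ⊗ p) x y ⇔ MaybePW.Pointwise (rel p) (dropCap x) (dropCap y)
cap⊗-rel c d p x y = mk⇔ (fw x y) (bw x y)
  where
  fw : ∀ x y → rel (((pairPart c d) *) ⊗ p) x y → MaybePW.Pointwise (rel p) (dropCap x) (dropCap y)
  fw (inj₁ i) (inj₁ j) (SumPW.inj₂ r) = MaybePW.just r
  fw (inj₁ i) (inj₂ (suc (suc j))) (SumPW.inj₂ r) = MaybePW.just r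
  fw (inj₂ (suc (suc i))) (inj₁ j) (SumPW.inj₂ r) = MaybePW.just r
  fw (inj₂ (suc (suc i))) (inj₂ (suc (suc j))) (SumPW.inj₂ r) = MaybePW.just r
  fw (inj₂ zero) (inj₂ zero) _ = MaybePW.nothing
  fw (inj₂ zero) (inj₂ (suc zero)) _ = MaybePW.nothing
  fw (inj₂ (suc zero)) (inj₂ zero) _ = MaybePW.nothing
  fw (inj₂ (suc zero)) (inj₂ (suc zero)) _ = MaybePW.nothing
  fw (inj₁ i) (inj₂ zero) ()
  fw (inj₁ i) (inj₂ (suc zero)) ()
  fw (inj₂ zero) (inj₁ j) ()
  fw (inj₂ (suc zero)) (inj₁ j) ()
  fw (inj₂ zero) (inj₂ (suc (suc j))) ()
  fw (inj₂ (suc zero)) (inj₂ (suc (suc j))) ()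
  fw (inj₂ (suc (suc i))) (inj₂ zero) ()
  fw (inj₂ (suc (suc i))) (inj₂ (suc zero)) ()
  bw : ∀ x y → MaybePW.Pointwise (rel p) (dropCap x) (dropCap y) → rel (((pairPart c d) *) ⊗ p) x y
  bw (inj₁ i) (inj₁ j) (MaybePW.just r) = SumPW.inj₂ r
  bw (inj₁ i) (inj₂ (suc (suc j))) (MaybePW.just r) = SumPW.inj₂ r
  bw (inj₂ (suc (suc i))) (inj₁ j) (MaybePW.just r) = SumPW.inj₂ r
  bw (inj₂ (suc (suc i))) (inj₂ (suc (suc j))) (MaybePW.just r) = SumPW.inj₂ r
  bw (inj₂ zero) (inj₂ zero) _ = SumPW.inj₁ tt
  bw (inj₂ zero) (inj₂ (suc zero)) _ = SumPW.inj₁ tt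
  bw (inj₂ (suc zero)) (inj₂ zero) _ = SumPW.inj₁ tt
  bw (inj₂ (suc zero)) (inj₂ (suc zero)) _ = SumPW.inj₁ tt

-- Identities, caps and the partitions that rotate a row

column : ∀ {k} → Pt k k → Fin k
column (inj₁ i) = i
column (inj₂ i) = i

identity : ∀ {k} (w : Vec Col k) → Part w w
identity w = byLabel column

leftCap : ∀ {k} (c : Col) (lo : Vec Col k) → Part lo (inv c ∷ c ∷ lo)
leftCap c lo = byLabel (λ x → Maybe.map column (dropCap x))

-- Upper point
-- j is labelled by min j k, so that the upper points k and k+1 coincide.
rightCapLabel : ∀ {k} → Pt k (suc k + 1) → ℕ
rightCapLabel (inj₁ i) = toℕ i
rightCapLabel {k} (inj₂ j) = toℕ j ⊓ k

rightCap : ∀ {k} (lo : Vec Col k) (c : Col) → Part lo ((lo ∷ʳ c) ++ (inv c ∷ []))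
rightCap lo c = byLabel rightCapLabel

module Members {k₀ l₀} {lo₀ : Vec Col k₀} {up₀ : Vec Col l₀} (p₀ : Part lo₀ up₀) where

  emptyMember : (q : Part [] []) → ⟨ p₀ ⟩ q
  emptyMember q = resp (λ { (inj₁ ()) _ ; (inj₂ ()) _ }) (comp (invol pairBW) pairBW)

  pairMember : ∀ c → ⟨ p₀ ⟩ (pairPart (inv c) c)
  pairMember white = pairBW
  pairMember black = pairWB

  pairMember' : ∀ c → ⟨ p₀ ⟩ (pairPart c (inv c))
  pairMember' white = pairWB
  pairMember' black = pairBW

  idMember : ∀ c → ⟨ p₀ ⟩ (idPart c)
  idMember white = idW
  idMember black = idB

  -- identity (d ∷ w) = idPart d ⊗ identity w
  identityMember : ∀ {k} (w : Vec Col k) → ⟨ p₀ ⟩ (identity w)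
  identityMember [] = emptyMember _
  identityMember (d ∷ w) =
    resp (id⊗byLabel {lo = w} {w} d column column shiftFin shiftFin-injective shift-column) (tens (idMember d) (identityMember w))
    where
    shift-column : ∀ {k} (x : Pt (suc k) (suc k)) → column x ≡ shiftFin (Maybe.map column (dropFirst x))
    shift-column (inj₁ zero) = refl
    shift-column (inj₁ (suc i)) = refl
    shift-column (inj₂ zero) = refl
    shift-column (inj₂ (suc i)) = refl

  -- leftCap c lo = (pairPart (inv c) c)* ⊗ identity lo
  leftCapMember : ∀ {k} c (lo : Vec Col k) → ⟨ p₀ ⟩ (leftCap c lo)
  leftCapMember c lo = resp e (tens (invol (pairMember c)) (identityMember lo))
    where
    e : (((pairPart (inv c) c) *) ⊗ identity lo) ≈ₚ leftCap c lo
    e x y = ⇔.trans (cap⊗-rel (inv c) c (identity lo) x y) (pointwise-map column (dropCap x) (dropCap y))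

  -- rightCap [] c = (pairPart c (inv c))* , rightCap (d ∷ lo) c = idPart d ⊗ rightCap lo c
  rightCapMember : ∀ {k} (lo : Vec Col k) c → ⟨ p₀ ⟩ (rightCap lo c)
  rightCapMember [] c = resp e (invol (pairMember' c))
    where
    min0 : ∀ n → n ⊓ 0 ≡ 0
    min0 zero = refl
    min0 (suc n) = refl
    e : ((pairPart c (inv c)) *) ≈ₚ rightCap [] c
    e (inj₂ x) (inj₂ y) = mk⇔ (λ _ → trans (min0 (toℕ x)) (sym (min0 (toℕ y)))) (λ _ → tt)
  rightCapMember (d ∷ lo) c =
    resp (id⊗byLabel {lo = lo} {(lo ∷ʳ c) ++ (inv c ∷ [])} d rightCapLabel rightCapLabel shiftℕ shiftℕ-injective shift-label) (tens (idMember d) (rightCapMember lo c))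
    where
    shift-label : ∀ {k} (x : Pt (suc k) (suc (suc k) + 1)) → rightCapLabel x ≡ shiftℕ (Maybe.map rightCapLabel (dropFirst x))
    shift-label (inj₁ zero) = refl
    shift-label (inj₁ (suc i)) = refl
    shift-label (inj₂ zero) = refl
    shift-label (inj₂ (suc j)) = refl

posℕ< : ∀ {k l} (a : Pt k l) → posℕ a < k + l
posℕ< {k} {l} (inj₁ i) = NP.<-≤-trans (FP.toℕ<n i) (NP.m≤m+n k l)
posℕ< {k} {l} (inj₂ j) = NP.+-monoʳ-< k (FP.toℕ<n (opposite j))

posℕ-upper : ∀ {k l} (j : Fin l) → k ≤ posℕ {k} {l} (inj₂ j)
posℕ-upper {k} j = NP.m≤m+n k _

atPos-posℕ : ∀ {k l} (t : Fin (k + l)) (a : Pt k l) → toℕ t ≡ posℕ a → atPos t ≡ a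
atPos-posℕ {k} {l} t a e with splitAt k t in eq
atPos-posℕ {k} {l} t (inj₁ i) e | inj₁ i' =
  cong inj₁ (FP.toℕ-injective (trans (sym (FP.toℕ-↑ˡ i' l)) (trans (cong toℕ (FP.splitAt⁻¹-↑ˡ {k} {l} eq)) e)))
atPos-posℕ {k} {l} t (inj₂ j) e | inj₁ i' =
  ⊥-elim (NP.<⇒≱ (FP.toℕ<n i')
     (subst (k ≤_) (sym (trans (sym (FP.toℕ-↑ˡ i' l)) (trans (cong toℕ (FP.splitAt⁻¹-↑ˡ {k} {l} eq)) e))) (posℕ-upper j)))
atPos-posℕ {k} {l} t (inj₁ i) e | inj₂ j' =
  ⊥-elim (NP.<⇒≱ (FP.toℕ<n i)
     (subst (k ≤_) (trans (sym (FP.toℕ-↑ʳ k j')) (trans (cong toℕ (FP.splitAt⁻¹-↑ʳ {k} {l} eq)) e)) (NP.m≤m+n k _)))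
atPos-posℕ {k} {l} t (inj₂ j) e | inj₂ j' =
  cong inj₂ (trans (cong opposite (FP.toℕ-injective (NP.+-cancelˡ-≡ k _ _
     (trans (sym (FP.toℕ-↑ʳ k j')) (trans (cong toℕ (FP.splitAt⁻¹-↑ʳ {k} {l} eq)) e)))))
     (FP.opposite-involutive j))

posℕ-atPos : ∀ {k l} (t : Fin (k + l)) → posℕ (atPos {k} {l} t) ≡ toℕ t
posℕ-atPos {k} {l} t with splitAt k t in eq
... | inj₁ i = trans (sym (FP.toℕ-↑ˡ i l)) (cong toℕ (FP.splitAt⁻¹-↑ˡ {k} {l} eq))
... | inj₂ j = trans (cong (k +_) (cong toℕ (FP.opposite-involutive j)))
                     (trans (sym (FP.toℕ-↑ʳ k j)) (cong toℕ (FP.splitAt⁻¹-↑ʳ {k} {l} eq)))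

posℕ-injective : ∀ {k l} (a b : Pt k l) → posℕ a ≡ posℕ b → a ≡ b
posℕ-injective a b e = trans (sym (atPos-posℕ (fromℕ< (posℕ< a)) a (FP.toℕ-fromℕ< _)))
                             (atPos-posℕ (fromℕ< (posℕ< a)) b (trans (FP.toℕ-fromℕ< _) e))

upperAt : ∀ {k l} d → k ≤ d → d < k + l → Σ (Fin l) λ j → posℕ {k} {l} (inj₂ j) ≡ d
upperAt {k} {l} d k≤d d<n with atPos {k} {l} (fromℕ< d<n) in eq
... | inj₁ i = ⊥-elim (NP.<⇒≱ (subst (_< k) (trans (cong posℕ (sym eq)) (trans (posℕ-atPos {k} {l} (fromℕ< d<n)) (FP.toℕ-fromℕ< d<n))) (FP.toℕ<n i)) k≤d)
... | inj₂ j = j , trans (cong posℕ (sym eq)) (trans (posℕ-atPos {k} {l} (fromℕ< d<n)) (FP.toℕ-fromℕ< d<n))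

-- Swapping the rows reverses the cyclic order.
posℕ-swap : ∀ {k l} (a : Pt k l) → suc (posℕ {k} {l} a + posℕ {l} {k} (swap a)) ≡ k + l
posℕ-swap {k} {l} (inj₁ i) = begin
  suc (toℕ i + (l + toℕ (opposite i)))  ≡⟨ cong (λ z → suc (toℕ i + (l + z))) (FP.opposite-prop i) ⟩
  suc (toℕ i + (l + (k ∸ suc (toℕ i)))) ≡⟨ NP.+-suc (toℕ i) _ ⟨
  toℕ i + suc (l + (k ∸ suc (toℕ i)))   ≡⟨ cong (toℕ i +_) (cong suc (NP.+-comm l _)) ⟩
  toℕ i + suc ((k ∸ suc (toℕ i)) + l)   ≡⟨ cong (toℕ i +_) (NP.+-suc (k ∸ suc (toℕ i)) l) ⟨
  toℕ i + ((k ∸ suc (toℕ i)) + suc l)   ≡⟨ NP.+-assoc (toℕ i) _ (suc l) ⟨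
  (toℕ i + (k ∸ suc (toℕ i))) + suc l   ≡⟨ NP.+-suc _ l ⟩
  suc (toℕ i + (k ∸ suc (toℕ i))) + l   ≡⟨ cong (_+ l) (NP.m+[n∸m]≡n (FP.toℕ<n i)) ⟩
  k + l                                  ∎
  where open ≡-Reasoning
posℕ-swap {k} {l} (inj₂ j) = begin
  suc (k + toℕ (opposite j) + toℕ j)    ≡⟨ cong (λ z → suc (k + z + toℕ j)) (FP.opposite-prop j) ⟩
  suc (k + (l ∸ suc (toℕ j)) + toℕ j)   ≡⟨ NP.+-suc _ (toℕ j) ⟨
  k + (l ∸ suc (toℕ j)) + suc (toℕ j)   ≡⟨ NP.+-assoc k _ _ ⟩
  k + ((l ∸ suc (toℕ j)) + suc (toℕ j)) ≡⟨ cong (k +_) (NP.m∸n+n≡m (FP.toℕ<n j)) ⟩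
  k + l                                  ∎
  where open ≡-Reasoning

ncol-swap : ∀ {k l} (lo : Vec Col k) (up : Vec Col l) (a : Pt k l) → ncol lo up a ≡ inv (ncol up lo (swap a))
ncol-swap lo up (inj₁ i) = sym (inv-involutive _)
ncol-swap lo up (inj₂ j) = refl

-- rotateLeft p = leftCap c lo · (idPart (inv c) ⊗ p) moves the leftmost lower
-- point of p to the left end of the upper row; every point x of the result
-- corresponds to the point  source x  of p.
module RotateLeft {k l} {c : Col} {lo : Vec Col k} {up : Vec Col l} (p : Part (c ∷ lo) up) where

  extended : Part (inv c ∷ c ∷ lo) (inv c ∷ up)
  extended = idPart (inv c) ⊗ p

  rotated : Part lo (inv c ∷ up)
  rotated = leftCap c lo · extended

  -- the point of p that a point of the three rows of the composition stands for
  collapse : Pt3 k (suc (suc k)) (suc l) → Pt (suc k) l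
  collapse (inj₁ i) = inj₁ (suc i)
  collapse (inj₂ (inj₁ zero)) = inj₁ zero
  collapse (inj₂ (inj₁ (suc zero))) = inj₁ zero
  collapse (inj₂ (inj₁ (suc (suc j)))) = inj₁ (suc j)
  collapse (inj₂ (inj₂ zero)) = inj₁ zero
  collapse (inj₂ (inj₂ (suc j))) = inj₂ j

  source : Pt k (suc l) → Pt (suc k) l
  source x = collapse (outer x)

  collapse-cap : ∀ a → collapse (embP a) ≡ inj₁ (shiftFin (Maybe.map column (dropCap a)))
  collapse-cap (inj₁ i) = refl
  collapse-cap (inj₂ zero) = refl
  collapse-cap (inj₂ (suc zero)) = refl
  collapse-cap (inj₂ (suc (suc j))) = refl

  collapse-extended : ∀ a → collapse (embQ a) ≡ Maybe.fromMaybe (inj₁ zero) (dropFirst a)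
  collapse-extended (inj₁ zero) = refl
  collapse-extended (inj₁ (suc zero)) = refl
  collapse-extended (inj₁ (suc (suc j))) = refl
  collapse-extended (inj₂ zero) = refl
  collapse-extended (inj₂ (suc j)) = refl

  lift : Pt (suc k) l → Pt (suc (suc k)) (suc l)
  lift (inj₁ i) = inj₁ (suc i)
  lift (inj₂ j) = inj₂ (suc j)

  dropFirst-lift : ∀ a → dropFirst (lift a) ≡ just a
  dropFirst-lift (inj₁ i) = refl
  dropFirst-lift (inj₂ j) = refl

  open Composition (leftCap c lo) extended

  toSource : ∀ x → Path (outer x) (embQ (lift (source x)))
  toSource (inj₁ i) = viaP {inj₁ i} {inj₂ (suc (suc i))} refl
  toSource (inj₂ zero) = viaQ {inj₂ zero} {inj₁ zero} (SumPW.inj₁ tt) ◅◅ viaP {inj₂ zero} {inj₂ (suc zero)} refl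
  toSource (inj₂ (suc j)) = ε

  rel-rotated : ∀ x y → rel rotated x y ⇔ rel p (source x) (source y)
  rel-rotated x y = mk⇔ (invariant (equiv p) collapse onCap onExtended x y)
                        (λ r → toSource x ◅◅ (viaQ (onLift r) ◅◅ reverse (toSource y)))
    where
    onLift : ∀ {a b} → rel p a b → rel extended (lift a) (lift b)
    onLift {a} {b} r = from (id⊗-rel (inv c) p (lift a) (lift b))
                             (subst₂ (MaybePW.Pointwise (rel p)) (sym (dropFirst-lift a)) (sym (dropFirst-lift b)) (MaybePW.just r))
    fromMaybe-rel : ∀ u v → MaybePW.Pointwise (rel p) u v →
                    rel p (Maybe.fromMaybe (inj₁ zero) u) (Maybe.fromMaybe (inj₁ zero) v)
    fromMaybe-rel _ _ (MaybePW.just r) = r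
    fromMaybe-rel _ _ MaybePW.nothing = IsEquivalence.refl (equiv p)
    onCap : ∀ a b → rel (leftCap c lo) a b → rel p (collapse (embP a)) (collapse (embP b))
    onCap a b e = rel-≡ p (trans (collapse-cap a) (trans (cong (λ u → inj₁ (shiftFin u)) e) (sym (collapse-cap b))))
    onExtended : ∀ a b → rel extended a b → rel p (collapse (embQ a)) (collapse (embQ b))
    onExtended a b r = subst₂ (rel p) (sym (collapse-extended a)) (sym (collapse-extended b))
                         (fromMaybe-rel (dropFirst a) (dropFirst b) (to (id⊗-rel (inv c) p a b) r))

  ncol-rotated : ∀ x → ncol lo (inv c ∷ up) x ≡ ncol (c ∷ lo) up (source x)
  ncol-rotated (inj₁ i) = refl
  ncol-rotated (inj₂ zero) = inv-involutive c
  ncol-rotated (inj₂ (suc j)) = refl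

  -- the cyclic order is rotated by one step
  posℕ-source : ∀ x → (suc (posℕ {k} {suc l} x) ≡ posℕ {suc k} {l} (source x))
                    ⊎ (posℕ {suc k} {l} (source x) ≡ 0 × suc (posℕ {k} {suc l} x) ≡ k + suc l)
  posℕ-source (inj₁ i) = inj₁ refl
  posℕ-source (inj₂ zero) = inj₂ (refl , trans (cong (λ z → suc (k + z)) (FP.toℕ-fromℕ l)) (sym (NP.+-suc k l)))
  posℕ-source (inj₂ (suc j)) = inj₁ (cong (λ z → suc (k + z)) (FP.opposite-suc j))

lookup-init : ∀ {k} (lo : Vec Col k) c (i : Fin k) → lookup lo i ≡ lookup (lo ∷ʳ c) (inject₁ i)
lookup-init (x ∷ lo) c zero = refl
lookup-init (x ∷ lo) c (suc i) = lookup-init lo c i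

lookup-last : ∀ {k} (lo : Vec Col k) c → lookup (lo ∷ʳ c) (fromℕ k) ≡ c
lookup-last [] c = refl
lookup-last (x ∷ lo) c = lookup-last lo c

splitPt-lower : ∀ {k k' l l'} (i : Fin (k + k')) → splitPt {k} {k'} {l} {l'} (inj₁ i) ≡ Sum.map inj₁ inj₁ (splitAt k i)
splitPt-lower {k} i with splitAt k i
... | inj₁ a = refl
... | inj₂ b = refl

splitPt-upper : ∀ {k k' l l'} (j : Fin (l + l')) → splitPt {k} {k'} {l} {l'} (inj₂ j) ≡ Sum.map inj₂ inj₂ (splitAt l j)
splitPt-upper {l = l} j with splitAt l j
... | inj₁ a = refl
... | inj₂ b = refl

-- rotateRight p = rightCap lo c · (p ⊗ idPart (inv c)) moves the rightmost
-- lower point of p to the right end of the upper row; positions in the cyclic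
-- order do not change.
module RotateRight {k l} {c : Col} {lo : Vec Col k} {up : Vec Col l} (p : Part (lo ∷ʳ c) up) where

  extended : Part ((lo ∷ʳ c) ++ (inv c ∷ [])) (up ++ (inv c ∷ []))
  extended = p ⊗ idPart (inv c)

  rotated : Part lo (up ++ (inv c ∷ []))
  rotated = rightCap lo c · extended

  -- a point of extended stands for itself or, in the last column, for the last lower point
  retract : Pt (suc k) l ⊎ Pt 1 1 → Pt (suc k) l
  retract (inj₁ u) = u
  retract (inj₂ _) = inj₁ (fromℕ k)

  collapse : Pt3 k (suc k + 1) (l + 1) → Pt (suc k) l
  collapse (inj₁ i) = inj₁ (inject₁ i)
  collapse (inj₂ z) = retract (splitPt {suc k} {1} {l} {1} z)

  source : Pt k (l + 1) → Pt (suc k) l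
  source x = collapse (outer x)

  k≤last : k ≤ toℕ (suc k ↑ʳ zero {0})
  k≤last = subst (k ≤_) (sym (FP.toℕ-↑ʳ (suc k) (zero {0}))) (NP.≤-trans (NP.n≤1+n k) (NP.m≤m+n (suc k) 0))

  collapse-cap : ∀ a → Σ (Fin (suc k)) λ F → collapse (embP a) ≡ inj₁ F × toℕ F ≡ rightCapLabel a
  collapse-cap (inj₁ i) = inject₁ i , refl , FP.toℕ-inject₁ i
  collapse-cap (inj₂ j) = bySplit (splitAt (suc k) j) refl
    where
    open ≡-Reasoning
    bySplit : ∀ s → splitAt (suc k) j ≡ s →
              Σ (Fin (suc k)) λ F → collapse (embP (inj₂ j)) ≡ inj₁ F × toℕ F ≡ rightCapLabel {k} (inj₂ j)
    bySplit (inj₁ a) eq = a , trans (cong retract (splitPt-lower j)) (cong (λ s → retract (Sum.map inj₁ inj₁ s)) eq)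
                        , (begin toℕ a                ≡⟨ NP.m≤n⇒m⊓n≡m (ℕ.s≤s⁻¹ (FP.toℕ<n a)) ⟨
                                 toℕ a ⊓ k            ≡⟨ cong (_⊓ k) (FP.toℕ-↑ˡ a 1) ⟨
                                 toℕ (a ↑ˡ 1) ⊓ k     ≡⟨ cong (λ (z : Fin (suc k + 1)) → toℕ z ⊓ k) (FP.splitAt⁻¹-↑ˡ {suc k} {1} eq) ⟩
                                 toℕ j ⊓ k            ∎)
    bySplit (inj₂ zero) eq = fromℕ k , trans (cong retract (splitPt-lower j)) (cong (λ s → retract (Sum.map inj₁ inj₁ s)) eq)
                        , (begin toℕ (fromℕ k)                  ≡⟨ FP.toℕ-fromℕ k ⟩
                                 k                              ≡⟨ NP.m≥n⇒m⊓n≡n k≤last ⟨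
                                 toℕ (suc k ↑ʳ zero {0}) ⊓ k     ≡⟨ cong (λ (z : Fin (suc k + 1)) → toℕ z ⊓ k) (FP.splitAt⁻¹-↑ʳ {suc k} {1} eq) ⟩
                                 toℕ j ⊓ k                      ∎)

  lift : Pt (suc k) l → Pt (suc k + 1) (l + 1)
  lift (inj₁ i) = inj₁ (i ↑ˡ 1)
  lift (inj₂ j) = inj₂ (j ↑ˡ 1)

  splitPt-lift : ∀ a → splitPt {suc k} {1} {l} {1} (lift a) ≡ inj₁ a
  splitPt-lift (inj₁ i) = trans (splitPt-lower (i ↑ˡ 1)) (cong (Sum.map inj₁ inj₁) (FP.splitAt-↑ˡ (suc k) i 1))
  splitPt-lift (inj₂ j) = trans (splitPt-upper (j ↑ˡ 1)) (cong (Sum.map inj₂ inj₂) (FP.splitAt-↑ˡ l j 1))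

  upperView : ∀ h → (Σ (Fin l) λ a → h ≡ a ↑ˡ 1 × source (inj₂ h) ≡ inj₂ a)
                  ⊎ (h ≡ l ↑ʳ zero × source (inj₂ h) ≡ inj₁ (fromℕ k) × splitPt {suc k} {1} {l} {1} (inj₂ h) ≡ inj₂ (inj₂ zero))
  upperView h with splitAt l h in eq
  ... | inj₁ a = inj₁ (a , sym (FP.splitAt⁻¹-↑ˡ {l} {1} eq) , refl)
  ... | inj₂ zero = inj₂ (sym (FP.splitAt⁻¹-↑ʳ {l} {1} eq) , refl , refl)

  open Composition (rightCap lo c) extended

  toSource : ∀ x → Path (outer x) (embQ (lift (source x)))
  toSource (inj₁ i) = viaP {inj₁ i} {inj₂ (inject₁ i ↑ˡ 1)}
    (sym (trans (cong (_⊓ k) (trans (FP.toℕ-↑ˡ (inject₁ i) 1) (FP.toℕ-inject₁ i))) (NP.m≤n⇒m⊓n≡m (NP.<⇒≤ (FP.toℕ<n i)))))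
  toSource (inj₂ h) with upperView h
  ... | inj₁ (a , refl , e) = subst (λ z → Path (inj₂ (inj₂ (a ↑ˡ 1))) (embQ (lift z))) (sym e) ε
  ... | inj₂ (refl , e , s) = subst (λ z → Path (inj₂ (inj₂ (l ↑ʳ zero))) (embQ (lift z))) (sym e)
          (viaQ {inj₂ (l ↑ʳ zero)} {inj₁ (suc k ↑ʳ zero)} lastColumn ◅◅ viaP {inj₂ (suc k ↑ʳ zero)} {inj₂ (fromℕ k ↑ˡ 1)} capLabels)
    where
    lastColumn : rel extended (inj₂ (l ↑ʳ zero)) (inj₁ (suc k ↑ʳ zero))
    lastColumn = subst₂ (Pointwise (rel p) trivRel) (sym s)
                   (sym (trans (splitPt-lower (suc k ↑ʳ zero)) (cong (Sum.map inj₁ inj₁) (FP.splitAt-↑ʳ (suc k) 1 zero))))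
                   (SumPW.inj₂ tt)
    capLabels : toℕ (suc k ↑ʳ zero {0}) ⊓ k ≡ toℕ (fromℕ k ↑ˡ 1) ⊓ k
    capLabels = trans (NP.m≥n⇒m⊓n≡n k≤last)
                      (sym (trans (cong (_⊓ k) (trans (FP.toℕ-↑ˡ (fromℕ k) 1) (FP.toℕ-fromℕ k))) (NP.⊓-idem k)))

  rel-rotated : ∀ x y → rel rotated x y ⇔ rel p (source x) (source y)
  rel-rotated x y = mk⇔ (invariant (equiv p) collapse onCap onExtended x y)
                        (λ r → toSource x ◅◅ (viaQ (onLift (source x) (source y) r) ◅◅ reverse (toSource y)))
    where
    onLift : ∀ a b → rel p a b → rel extended (lift a) (lift b)
    onLift a b r = subst₂ (Pointwise (rel p) trivRel) (sym (splitPt-lift a)) (sym (splitPt-lift b)) (SumPW.inj₁ r)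
    retract-rel : ∀ u v → Pointwise (rel p) (trivRel {Pt 1 1}) u v → rel p (retract u) (retract v)
    retract-rel _ _ (SumPW.inj₁ r) = r
    retract-rel _ _ (SumPW.inj₂ _) = IsEquivalence.refl (equiv p)
    onCap : ∀ a b → rel (rightCap lo c) a b → rel p (collapse (embP a)) (collapse (embP b))
    onCap a b e with collapse-cap a | collapse-cap b
    ... | F , ea , ta | G , eb , tb = rel-≡ p (trans ea (trans (cong inj₁ (FP.toℕ-injective (trans ta (trans e (sym tb))))) (sym eb)))
    collapse-ext : ∀ a → collapse (embQ a) ≡ retract (splitPt {suc k} {1} {l} {1} a)
    collapse-ext (inj₁ j) = refl
    collapse-ext (inj₂ j) = refl
    onExtended : ∀ a b → rel extended a b → rel p (collapse (embQ a)) (collapse (embQ b))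
    onExtended a b r = subst₂ (rel p) (sym (collapse-ext a)) (sym (collapse-ext b)) (retract-rel (splitPt a) (splitPt b) r)

  ncol-rotated : ∀ x → ncol lo (up ++ (inv c ∷ [])) x ≡ ncol (lo ∷ʳ c) up (source x)
  ncol-rotated (inj₁ i) = lookup-init lo c i
  ncol-rotated (inj₂ h) with upperView h
  ... | inj₁ (a , refl , e) = trans (cong inv (VP.lookup-++ˡ up (inv c ∷ []) a)) (cong (ncol (lo ∷ʳ c) up) (sym e))
  ... | inj₂ (refl , e , _) = trans (cong inv (VP.lookup-++ʳ up (inv c ∷ []) zero))
                                (trans (inv-involutive c) (trans (sym (lookup-last lo c)) (cong (ncol (lo ∷ʳ c) up) (sym e))))

  posℕ-source : ∀ x → posℕ {suc k} {l} (source x) ≡ posℕ {k} {l + 1} x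
  posℕ-source (inj₁ i) = FP.toℕ-inject₁ i
  posℕ-source (inj₂ h) with upperView h
  ... | inj₁ (a , refl , e) = begin
        posℕ {suc k} {l} (source (inj₂ (a ↑ˡ 1))) ≡⟨ cong posℕ e ⟩
        suc k + toℕ (opposite a)                   ≡⟨ cong (suc k +_) (FP.opposite-prop a) ⟩
        suc k + (l ∸ suc (toℕ a))                  ≡⟨ NP.+-suc k _ ⟨
        k + suc (l ∸ suc (toℕ a))                  ≡⟨ cong (k +_) (NP.+-∸-assoc 1 (FP.toℕ<n a)) ⟨
        k + (suc l ∸ suc (toℕ a))                  ≡⟨ cong (λ z → k + (z ∸ suc (toℕ a))) (NP.+-comm 1 l) ⟩
        k + ((l + 1) ∸ suc (toℕ a))                ≡⟨ cong (λ z → k + ((l + 1) ∸ suc z)) (FP.toℕ-↑ˡ a 1) ⟨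
        k + ((l + 1) ∸ suc (toℕ (a ↑ˡ 1)))         ≡⟨ cong (k +_) (FP.opposite-prop (a ↑ˡ 1)) ⟨
        k + toℕ (opposite (a ↑ˡ 1))                ∎
    where open ≡-Reasoning
  ... | inj₂ (refl , e , _) = begin
        posℕ {suc k} {l} (source (inj₂ (l ↑ʳ zero))) ≡⟨ cong posℕ e ⟩
        toℕ (fromℕ k)                                  ≡⟨ FP.toℕ-fromℕ k ⟩
        k                                              ≡⟨ NP.+-identityʳ k ⟨
        k + 0                                          ≡⟨ cong (k +_) lastOpposite ⟨
        k + toℕ (opposite (l ↑ʳ zero {0}))             ∎
    where
    open ≡-Reasoning
    lastOpposite : toℕ (opposite (l ↑ʳ zero {0})) ≡ 0
    lastOpposite = begin
      toℕ (opposite (l ↑ʳ zero {0}))      ≡⟨ FP.opposite-prop (l ↑ʳ zero) ⟩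
      (l + 1) ∸ suc (toℕ (l ↑ʳ zero {0})) ≡⟨ cong (λ z → (l + 1) ∸ suc z) (trans (FP.toℕ-↑ʳ l (zero {0})) (NP.+-identityʳ l)) ⟩
      (l + 1) ∸ suc l                     ≡⟨ cong (_∸ suc l) (NP.+-comm l 1) ⟩
      suc l ∸ suc l                       ≡⟨ NP.n∸n≡0 l ⟩
      0                                   ∎

posℕ-unswap : ∀ {k l k' l'} (a : Pt k l) (b : Pt k' l') → k + l ≡ k' + l' →
              posℕ {l} {k} (swap a) ≡ posℕ {l'} {k'} (swap b) → posℕ a ≡ posℕ b
posℕ-unswap {k} {l} {k'} {l'} a b sizes e = NP.+-cancelʳ-≡ _ _ _ (NP.suc-injective (begin
  suc (posℕ a + posℕ (swap a)) ≡⟨ posℕ-swap a ⟩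
  k + l                         ≡⟨ sizes ⟩
  k' + l'                       ≡⟨ posℕ-swap b ⟨
  suc (posℕ b + posℕ (swap b)) ≡⟨ cong (λ z → suc (posℕ b + z)) e ⟨
  suc (posℕ b + posℕ (swap a)) ∎))
  where open ≡-Reasoning

-- A rotated copy of p₀ by w steps is a partition in ⟨ p₀ ⟩ with k lower and
-- l upper points whose point at cyclic position i behaves (blocks, colours)
-- like the point of p₀ at cyclic position w + i.  Moving points between the
-- ends of the rows produces all rotated copies with any given lower row
-- length; in particular a copy whose lower row is a prescribed interval.
module RotatedCopies {k₀ l₀} {lo₀ : Vec Col k₀} {up₀ : Vec Col l₀} (p₀ : Part lo₀ up₀)
                     (n : ℕ) (size₀ : k₀ + l₀ ≡ suc n) where
  open Members p₀

  N : ℕ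
  N = suc n

  index : ℕ → Fin (k₀ + l₀)
  index i = F.cast (sym size₀) (fromℕ< (m%n<n i N))

  toℕ-index : ∀ i → toℕ (index i) ≡ i % N
  toℕ-index i = trans (FP.toℕ-cast (sym size₀) _) (FP.toℕ-fromℕ< _)

  pt : ℕ → Pt k₀ l₀
  pt i = atPos (index i)

  pt-mod : ∀ i j → i % N ≡ j % N → pt i ≡ pt j
  pt-mod i j e = cong atPos (FP.toℕ-injective (trans (toℕ-index i) (trans e (sym (toℕ-index j)))))

  pt-posℕ : ∀ a → pt (posℕ a) ≡ a
  pt-posℕ a = atPos-posℕ (index (posℕ a)) a (trans (toℕ-index (posℕ a)) (m<n⇒m%n≡m (subst (posℕ a <_) size₀ (posℕ< a))))

  record Copy (w k l : ℕ) : Set₁ where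
    constructor copy
    field
      lo : Vec Col k
      up : Vec Col l
      part : Part lo up
      member : ⟨ p₀ ⟩ part
      size : k + l ≡ N
      rel-shifted : ∀ a b → rel part a b ⇔ rel p₀ (pt (w + posℕ a)) (pt (w + posℕ b))
      ncol-shifted : ∀ a → ncol lo up a ≡ ncol lo₀ up₀ (pt (w + posℕ a))

  original : Copy 0 k₀ l₀
  original = copy lo₀ up₀ p₀ gen size₀ (λ a b → ⇔-cong₂ (rel p₀) (sym (pt-posℕ a)) (sym (pt-posℕ b)))
                  (λ a → cong (ncol lo₀ up₀) (sym (pt-posℕ a)))

  turnLeft : ∀ {w k l} → Copy w (suc k) l → Copy (suc w) k (suc l)
  turnLeft {w} {k} {l} (copy (c ∷ lo) up x m sz rx cx) =
    copy lo (inv c ∷ up) rotated (comp (leftCapMember c lo) (tens (idMember (inv c)) m)) sz' rx' cx'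
    where
    open RotateLeft x
    sz' : k + suc l ≡ N
    sz' = trans (NP.+-suc k l) sz
    samePt : ∀ a → pt (w + posℕ (source a)) ≡ pt (suc w + posℕ a)
    samePt a with posℕ-source a
    ... | inj₁ e = cong pt (trans (cong (w +_) (sym e)) (NP.+-suc w _))
    ... | inj₂ (e0 , e1) = pt-mod (w + posℕ (source a)) (suc w + posℕ a) (begin
          (w + posℕ (source a)) % N ≡⟨ cong (λ z → (w + z) % N) e0 ⟩
          (w + 0) % N               ≡⟨ cong (_% N) (NP.+-identityʳ w) ⟩
          w % N                     ≡⟨ [m+n]%n≡m%n w N ⟨
          (w + N) % N               ≡⟨ cong (λ z → (w + z) % N) (trans e1 sz') ⟨
          (w + suc (posℕ a)) % N    ≡⟨ cong (_% N) (NP.+-suc w _) ⟩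
          (suc w + posℕ a) % N      ∎)
      where open ≡-Reasoning
    rx' : ∀ a b → rel rotated a b ⇔ rel p₀ (pt (suc w + posℕ a)) (pt (suc w + posℕ b))
    rx' a b = ⇔.trans (rel-rotated a b) (⇔.trans (rx (source a) (source b)) (⇔-cong₂ (rel p₀) (samePt a) (samePt b)))
    cx' : ∀ a → ncol lo (inv c ∷ up) a ≡ ncol lo₀ up₀ (pt (suc w + posℕ a))
    cx' a = trans (ncol-rotated a) (trans (cx (source a)) (cong (ncol lo₀ up₀) (samePt a)))

  turnRight : ∀ {w k l} → Copy w (suc k) l → Copy w k (suc l)
  turnRight {w} {k} {l} (copy lo up x m sz rx cx) with initLast lo
  ... | u , c , refl = subst (Copy w k) (NP.+-comm l 1)
        (copy u (up ++ (inv c ∷ [])) rotated (comp (rightCapMember u c) (tens m (idMember (inv c)))) sz' rx' cx')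
    where
    open RotateRight x
    sz' : k + (l + 1) ≡ N
    sz' = trans (cong (k +_) (NP.+-comm l 1)) (trans (NP.+-suc k l) sz)
    samePt : ∀ a → pt (w + posℕ (source a)) ≡ pt (w + posℕ a)
    samePt a = cong (λ z → pt (w + z)) (posℕ-source a)
    rx' : ∀ a b → rel rotated a b ⇔ rel p₀ (pt (w + posℕ a)) (pt (w + posℕ b))
    rx' a b = ⇔.trans (rel-rotated a b) (⇔.trans (rx (source a) (source b)) (⇔-cong₂ (rel p₀) (samePt a) (samePt b)))
    cx' : ∀ a → ncol u (up ++ (inv c ∷ [])) a ≡ ncol lo₀ up₀ (pt (w + posℕ a))
    cx' a = trans (ncol-rotated a) (trans (cx (source a)) (cong (ncol lo₀ up₀) (samePt a)))

  -- Moving the last upper point to the lower row (the mirror image of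
  -- turnRight) keeps the copy.
  turnBack : ∀ {w k l} → Copy w k (suc l) → Copy w (suc k) l
  turnBack {w} {k} {l} (copy lo up x m sz rx cx) with initLast up
  ... | u , c , refl = subst (λ k → Copy w k l) (NP.+-comm k 1)
        (copy (lo ++ (inv c ∷ [])) u (rotated *) (invol (comp (rightCapMember u c) (tens (invol m) (idMember (inv c))))) sz' rx' cx')
    where
    open RotateRight (x *)
    sz' : (k + 1) + l ≡ N
    sz' = trans (NP.+-assoc k 1 l) sz
    mirrored : Pt (k + 1) l → Pt k (suc l)
    mirrored a = swap (source (swap a))
    posℕ-mirrored : ∀ a → posℕ (mirrored a) ≡ posℕ a
    posℕ-mirrored a = posℕ-unswap (mirrored a) a (sym (NP.+-assoc k 1 l))
                        (trans (cong posℕ (SP.swap-involutive (source (swap a)))) (posℕ-source (swap a)))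
    samePt : ∀ a → pt (w + posℕ (mirrored a)) ≡ pt (w + posℕ a)
    samePt a = cong (λ z → pt (w + z)) (posℕ-mirrored a)
    rx' : ∀ a b → rel (rotated *) a b ⇔ rel p₀ (pt (w + posℕ a)) (pt (w + posℕ b))
    rx' a b = ⇔.trans (rel-rotated (swap a) (swap b)) (⇔.trans (rx (mirrored a) (mirrored b)) (⇔-cong₂ (rel p₀) (samePt a) (samePt b)))
    cx' : ∀ a → ncol (lo ++ (inv c ∷ [])) u a ≡ ncol lo₀ up₀ (pt (w + posℕ a))
    cx' a = begin
      ncol (lo ++ (inv c ∷ [])) u a               ≡⟨ ncol-swap (lo ++ (inv c ∷ [])) u a ⟩
      inv (ncol u (lo ++ (inv c ∷ [])) (swap a))  ≡⟨ cong inv (ncol-rotated (swap a)) ⟩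
      inv (ncol (u ∷ʳ c) lo (source (swap a)))    ≡⟨ cong inv (ncol-swap (u ∷ʳ c) lo (source (swap a))) ⟩
      inv (inv (ncol lo (u ∷ʳ c) (mirrored a)))   ≡⟨ inv-involutive _ ⟩
      ncol lo (u ∷ʳ c) (mirrored a)               ≡⟨ cx (mirrored a) ⟩
      ncol lo₀ up₀ (pt (w + posℕ (mirrored a)))   ≡⟨ cong (ncol lo₀ up₀) (samePt a) ⟩
      ncol lo₀ up₀ (pt (w + posℕ a))              ∎
      where open ≡-Reasoning

  lowerAll : ∀ {w k} l → Copy w k l → Copy w N 0
  lowerAll {w} {k} zero s = subst (λ k → Copy w k 0) (trans (sym (NP.+-identityʳ k)) (Copy.size s)) s
  lowerAll (suc l) s = lowerAll l (turnBack s)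

  -- each step moves the first point of the row to its end
  rotateBy : ∀ t → Copy 0 N 0 → Copy t N 0
  rotateBy zero s = s
  rotateBy (suc t) s = turnBack (turnLeft (rotateBy t s))

  raise : ∀ {w l} t {L} → Copy w (t + L) l → ∃ λ l' → Copy w L l'
  raise zero s = _ , s
  raise (suc t) s = raise t (turnRight s)

  copyWithLowerRow : ∀ w L → L ≤ N → ∃ λ l → Copy w L l
  copyWithLowerRow w L L≤N =
    raise (N ∸ L) (subst (λ k → Copy w k 0) (sym (NP.m∸n+n≡m L≤N)) (rotateBy w (lowerAll l₀ original)))

Lin : ℕ → ℕ → ℕ → ℕ → Set
Lin w x y z = w < x × x < y × y < z

-- a , b , c , d occur in this cyclic order (CycOrd unfolds to it on positions)
Cyclic : ℕ → ℕ → ℕ → ℕ → Set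
Cyclic a b c d = Lin a b c d ⊎ Lin b c d a ⊎ Lin c d a b ⊎ Lin d a b c

cyclic-rotate : ∀ {a b c d} → Cyclic a b c d → Cyclic b c d a
cyclic-rotate (inj₁ x) = inj₂ (inj₂ (inj₂ x))
cyclic-rotate (inj₂ (inj₁ x)) = inj₁ x
cyclic-rotate (inj₂ (inj₂ (inj₁ x))) = inj₂ (inj₁ x)
cyclic-rotate (inj₂ (inj₂ (inj₂ x))) = inj₂ (inj₂ (inj₁ x))

cyclic-cong : ∀ {a b c d a' b' c' d'} → a ≡ a' → b ≡ b' → c ≡ c' → d ≡ d' → Cyclic a b c d → Cyclic a' b' c' d'
cyclic-cong refl refl refl refl z = z

module CyclicShift (n : ℕ) where
  N : ℕ
  N = suc n

  next : ℕ → ℕ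
  next x = suc x % N

  next-view : ∀ x → x < N → (suc x < N × next x ≡ suc x) ⊎ (suc x ≡ N × next x ≡ 0)
  next-view x x<N with suc x ℕ.<? N
  ... | yes p = inj₁ (p , m<n⇒m%n≡m p)
  ... | no ¬p = inj₂ (e , trans (cong (_% N) e) (n%n≡0 N))
    where e = NP.≤-antisym x<N (NP.≮⇒≥ ¬p)

  next-above : ∀ {w x} → w < N → x < N → next w < next x → next x ≡ suc x
  next-above {w} {x} w<N x<N lt with next-view x x<N
  ... | inj₁ (_ , e) = e
  ... | inj₂ (_ , e) = ⊥-elim (NP.n≮0 (subst (next w <_) e lt))

  next-Lin : ∀ {w x y z} → Lin w x y z → z < N → Cyclic (next w) (next x) (next y) (next z)
  next-Lin {w} {x} {y} {z} (wx , xy , yz) z<N with next-view w (NP.<-trans wx (NP.<-trans xy (NP.<-trans yz z<N)))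
                                               | next-view x (NP.<-trans xy (NP.<-trans yz z<N))
                                               | next-view y (NP.<-trans yz z<N)
                                               | next-view z z<N
  ... | inj₂ (e , _) | _ | _ | _ = ⊥-elim (NP.<-irrefl e (NP.≤-<-trans (NP.<-trans wx (NP.<-trans xy yz)) z<N))
  ... | _ | inj₂ (e , _) | _ | _ = ⊥-elim (NP.<-irrefl e (NP.≤-<-trans (NP.<-trans xy yz) z<N))
  ... | _ | _ | inj₂ (e , _) | _ = ⊥-elim (NP.<-irrefl e (NP.≤-<-trans yz z<N))
  ... | inj₁ (_ , ew) | inj₁ (_ , ex) | inj₁ (_ , ey) | inj₁ (_ , ez) =
      inj₁ (subst₂ _<_ (sym ew) (sym ex) (s≤s wx) , subst₂ _<_ (sym ex) (sym ey) (s≤s xy) , subst₂ _<_ (sym ey) (sym ez) (s≤s yz))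
  ... | inj₁ (_ , ew) | inj₁ (_ , ex) | inj₁ (_ , ey) | inj₂ (_ , ez) =
      inj₂ (inj₂ (inj₂ (subst₂ _<_ (sym ez) (sym ew) (s≤s z≤n) , subst₂ _<_ (sym ew) (sym ex) (s≤s wx) , subst₂ _<_ (sym ex) (sym ey) (s≤s xy))))

  Lin-next : ∀ {w x y z} → w < N → x < N → y < N → z < N → Lin (next w) (next x) (next y) (next z) → Cyclic w x y z
  Lin-next {w} {x} {y} {z} wN xN yN zN (wx , xy , yz) = byFirst ex (ℕ.s<s⁻¹ (subst₂ _<_ ex ey xy)) (ℕ.s<s⁻¹ (subst₂ _<_ ey ez yz))
    where
    ex = next-above wN xN wx
    ey = next-above xN yN xy
    ez = next-above yN zN yz
    byFirst : next x ≡ suc x → x < y → y < z → Cyclic w x y z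
    byFirst ex x<y y<z with next-view w wN
    ... | inj₁ (_ , ew) = inj₁ (ℕ.s<s⁻¹ (subst₂ _<_ ew ex wx) , x<y , y<z)
    ... | inj₂ (e , _) = inj₂ (inj₁ (x<y , y<z , ℕ.s<s⁻¹ (subst (suc z <_) (sym e) (subst (_< N) ez (m%n<n (suc z) N)))))

  next-cyclic : ∀ {a b c d} → a < N → b < N → c < N → d < N → Cyclic a b c d → Cyclic (next a) (next b) (next c) (next d)
  next-cyclic aN bN cN dN (inj₁ l) = next-Lin l dN
  next-cyclic aN bN cN dN (inj₂ (inj₁ l)) = cyclic-rotate (cyclic-rotate (cyclic-rotate (next-Lin l aN)))
  next-cyclic aN bN cN dN (inj₂ (inj₂ (inj₁ l))) = cyclic-rotate (cyclic-rotate (next-Lin l bN))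
  next-cyclic aN bN cN dN (inj₂ (inj₂ (inj₂ l))) = cyclic-rotate (next-Lin l cN)

  cyclic-next : ∀ {a b c d} → a < N → b < N → c < N → d < N → Cyclic (next a) (next b) (next c) (next d) → Cyclic a b c d
  cyclic-next aN bN cN dN (inj₁ l) = Lin-next aN bN cN dN l
  cyclic-next aN bN cN dN (inj₂ (inj₁ l)) = cyclic-rotate (cyclic-rotate (cyclic-rotate (Lin-next bN cN dN aN l)))
  cyclic-next aN bN cN dN (inj₂ (inj₂ (inj₁ l))) = cyclic-rotate (cyclic-rotate (Lin-next cN dN aN bN l))
  cyclic-next aN bN cN dN (inj₂ (inj₂ (inj₂ l))) = cyclic-rotate (Lin-next dN aN bN cN l)

  shiftBy : ℕ → ℕ → ℕ
  shiftBy t x = (x + t) % N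

  shiftBy-zero : ∀ x → x < N → shiftBy 0 x ≡ x
  shiftBy-zero x xN = trans (cong (_% N) (NP.+-identityʳ x)) (m<n⇒m%n≡m xN)

  shiftBy-suc : ∀ t x → shiftBy (suc t) x ≡ next (shiftBy t x)
  shiftBy-suc t x = begin
    (x + suc t) % N                 ≡⟨ cong (_% N) (NP.+-suc x t) ⟩
    (1 + (x + t)) % N               ≡⟨ %-distribˡ-+ 1 (x + t) N ⟩
    (1 % N + (x + t) % N) % N       ≡⟨ cong (λ z → (1 % N + z) % N) (m%n%n≡m%n (x + t) N) ⟨
    (1 % N + (x + t) % N % N) % N   ≡⟨ %-distribˡ-+ 1 ((x + t) % N) N ⟨
    (1 + (x + t) % N) % N           ∎
    where open ≡-Reasoning

  cyclic-shiftBy : ∀ t {a b c d} → a < N → b < N → c < N → d < N →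
                   Cyclic a b c d ⇔ Cyclic (shiftBy t a) (shiftBy t b) (shiftBy t c) (shiftBy t d)
  cyclic-shiftBy zero {a} {b} {c} {d} aN bN cN dN =
    mk⇔ (cyclic-cong (sym (shiftBy-zero a aN)) (sym (shiftBy-zero b bN)) (sym (shiftBy-zero c cN)) (sym (shiftBy-zero d dN)))
        (cyclic-cong (shiftBy-zero a aN) (shiftBy-zero b bN) (shiftBy-zero c cN) (shiftBy-zero d dN))
  cyclic-shiftBy (suc t) {a} {b} {c} {d} aN bN cN dN =
    mk⇔ (λ z → cyclic-cong (sym (shiftBy-suc t a)) (sym (shiftBy-suc t b)) (sym (shiftBy-suc t c)) (sym (shiftBy-suc t d))
                  (next-cyclic (shifted< a) (shifted< b) (shifted< c) (shifted< d) (to (cyclic-shiftBy t aN bN cN dN) z)))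
        (λ z → from (cyclic-shiftBy t aN bN cN dN)
                  (cyclic-next (shifted< a) (shifted< b) (shifted< c) (shifted< d)
                     (cyclic-cong (shiftBy-suc t a) (shiftBy-suc t b) (shiftBy-suc t c) (shiftBy-suc t d) z)))
    where
    shifted< : ∀ x → shiftBy t x < N
    shifted< x = m%n<n (x + t) N

noCrossingInside : ∀ {α β γ δ m} → α < m → β < m → (γ ≡ 0 ⊎ γ ≡ m) → (δ ≡ 0 ⊎ δ ≡ m) → ¬ Cyclic α γ β δ
noCrossingInside αm βm (inj₁ refl) _ (inj₁ (() , _))
noCrossingInside αm βm (inj₂ refl) _ (inj₁ (_ , γβ , _)) = NP.<-asym γβ βm
noCrossingInside αm βm _ (inj₁ refl) (inj₂ (inj₁ (_ , () , _)))
noCrossingInside αm βm _ (inj₂ refl) (inj₂ (inj₁ (_ , _ , δα))) = NP.<-asym δα αm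
noCrossingInside αm βm _ (inj₁ refl) (inj₂ (inj₂ (inj₁ (() , _))))
noCrossingInside αm βm _ (inj₂ refl) (inj₂ (inj₂ (inj₁ (_ , δα , _)))) = NP.<-asym δα αm
noCrossingInside αm βm (inj₁ refl) _ (inj₂ (inj₂ (inj₂ (_ , () , _))))
noCrossingInside αm βm (inj₂ refl) _ (inj₂ (inj₂ (inj₂ (_ , _ , γβ)))) = NP.<-asym γβ βm

record Pairing {k l} {lo : Vec Col k} {up : Vec Col l} (X : Part lo up) : Set where
  field
    partner : Pt k l → Pt k l
    rel⇔partner : ∀ x y → rel X x y ⇔ (y ≡ x ⊎ y ≡ partner x)
    partner≢ : ∀ x → partner x ≢ x
    partner-involutive : ∀ x → partner (partner x) ≡ x

pairing : ∀ {k l} {lo : Vec Col k} {up : Vec Col l} (X : Part lo up) → IsPairPart X → Pairing X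
pairing X pp = record { partner = partner ; rel⇔partner = rel⇔partner ; partner≢ = partner≢ ; partner-involutive = involutive }
  where
  partner = λ x → proj₁ (pp x)
  rel⇔partner : ∀ x y → rel X x y ⇔ (y ≡ x ⊎ y ≡ partner x)
  rel⇔partner x y = proj₂ (proj₂ (pp x)) y
  partner≢ : ∀ x → partner x ≢ x
  partner≢ x = proj₁ (proj₂ (pp x))
  involutive : ∀ x → partner (partner x) ≡ x
  involutive x with to (rel⇔partner (partner x) x) (IsEquivalence.sym (equiv X) (from (rel⇔partner x (partner x)) (inj₂ refl)))
  ... | inj₁ e = ⊥-elim (partner≢ x (sym e))
  ... | inj₂ e = sym e

module PairingFacts {k l} {lo : Vec Col k} {up : Vec Col l} {X : Part lo up} (P : Pairing X) where
  open Pairing P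

  block⇔partner : ∀ x y → IsBlock2 X x y ⇔ y ≡ partner x
  block⇔partner x y = mk⇔ fw (λ { refl → rel⇔partner x })
    where
    fw : IsBlock2 X x y → y ≡ partner x
    fw b with to (b (partner x)) (from (rel⇔partner x (partner x)) (inj₂ refl))
    ... | inj₁ e = ⊥-elim (partner≢ x e)
    ... | inj₂ e = sym e

  rel-partner : ∀ x → rel X x (partner x)
  rel-partner x = from (rel⇔partner x (partner x)) (inj₂ refl)

  partner-injective : ∀ a b → partner a ≡ partner b → a ≡ b
  partner-injective a b e = trans (sym (partner-involutive a)) (trans (cong partner e) (partner-involutive b))

  related-partner : ∀ x y → rel X x y → y ≢ x → y ≡ partner x
  related-partner x y r ne with to (rel⇔partner x y) r
  ... | inj₁ e = ⊥-elim (ne e)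
  ... | inj₂ e = e

  -- Crossing with a boundary block, read off in coordinates ν that respect the
  -- cyclic order: if ν puts y at 0 and its partner at m, and x strictly between,
  -- then the blocks of x and y cross exactly when the partner of x lies beyond m.
  module Crossing (ν : Pt k l → ℕ)
                  (cyclic→ : ∀ a b c d → CycOrd a b c d → Cyclic (ν a) (ν b) (ν c) (ν d))
                  (cyclic← : ∀ a b c d → Cyclic (ν a) (ν b) (ν c) (ν d) → CycOrd a b c d) where

    crossesBoundary : ∀ x y {m} → 0 < ν x → ν x < m → ν y ≡ 0 → ν (partner y) ≡ m → ν (partner x) ≢ m →
                      Crosses X x y ⇔ m < ν (partner x)
    crossesBoundary x y {m} 0<x x<m y0 ym xm = mk⇔ fw bw
      where
      ends : ∀ z α → rel X z α → α ≡ z ⊎ α ≡ partner z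
      ends z α r = to (rel⇔partner z α) r
      endsY : ∀ α → rel X y α → ν α ≡ 0 ⊎ ν α ≡ m
      endsY α r with ends y α r
      ... | inj₁ refl = inj₁ y0
      ... | inj₂ refl = inj₂ ym
      fw : Crosses X x y → m < ν (partner x)
      fw (_ , α , β , γ , δ , rα , rβ , rγ , rδ , cy) with m ℕ.<? ν (partner x)
      ... | yes lt = lt
      ... | no ¬lt = ⊥-elim (noCrossingInside (inside α rα) (inside β rβ) (endsY γ rγ) (endsY δ rδ) (cyclic→ α γ β δ cy))
        where
        inside : ∀ α → rel X x α → ν α < m
        inside α r with ends x α r
        ... | inj₁ refl = x<m
        ... | inj₂ refl = NP.≤∧≢⇒< (NP.≮⇒≥ ¬lt) xm
      bw : m < ν (partner x) → Crosses X x y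
      bw lt = notRelated , x , partner x , partner y , y
            , IsEquivalence.refl (equiv X) , rel-partner x , rel-partner y , IsEquivalence.refl (equiv X)
            , cyclic← x (partner y) (partner x) y
                (inj₂ (inj₂ (inj₂ (subst (_< ν x) (sym y0) 0<x , subst (ν x <_) (sym ym) x<m , subst (_< ν (partner x)) (sym ym) lt))))
        where
        notRelated : ¬ rel X x y
        notRelated r with ends x y r
        ... | inj₁ refl = NP.<-irrefl (sym y0) 0<x
        ... | inj₂ refl = NP.<-irrefl (sym y0) (NP.<-trans (NP.≤-<-trans z≤n x<m) lt)

involutionPart : ∀ {k l} {lo : Vec Col k} {up : Vec Col l} (π : Pt k l → Pt k l) → (∀ x → π (π x) ≡ x) → Part lo up
involutionPart π ππ = record
  { rel = λ x y → y ≡ x ⊎ y ≡ π x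
  ; equiv = record { refl = inj₁ refl ; sym = symm ; trans = transit } }
  where
  symm : ∀ {x y} → (y ≡ x ⊎ y ≡ π x) → (x ≡ y ⊎ x ≡ π y)
  symm (inj₁ refl) = inj₁ refl
  symm {x} (inj₂ refl) = inj₂ (sym (ππ x))
  transit : ∀ {x y z} → (y ≡ x ⊎ y ≡ π x) → (z ≡ y ⊎ z ≡ π y) → (z ≡ x ⊎ z ≡ π x)
  transit (inj₁ refl) r = r
  transit (inj₂ refl) (inj₁ refl) = inj₂ refl
  transit {x} (inj₂ refl) (inj₂ refl) = inj₁ (ππ x)

involutionPairing : ∀ {k l} {lo : Vec Col k} {up : Vec Col l} (π : Pt k l → Pt k l) (ππ : ∀ x → π (π x) ≡ x) →
                    (∀ x → π x ≢ x) → Pairing (involutionPart {lo = lo} {up} π ππ)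
involutionPairing π ππ π≢ = record { partner = π ; rel⇔partner = λ _ _ → mk⇔ (λ r → r) (λ r → r)
                                   ; partner≢ = π≢ ; partner-involutive = ππ }

ptAt-lowerRow : ∀ m {d} (i : Fin (suc m)) → toℕ i ≡ d → ptAt (lowerRow m) d ≡ inj₁ i
ptAt-lowerRow m i refl = atPos-posℕ _ (inj₁ i)
  (trans (FP.toℕ-fromℕ< _) (m<n⇒m%n≡m (NP.<-≤-trans (FP.toℕ<n i) (NP.m≤m+n (suc m) (suc m)))))

module LowerRowCrossing {m l} {lo : Vec Col (suc m)} {up : Vec Col l} {X : Part lo up} (P : Pairing X)
                        (sector : Pairing.partner P (inj₁ zero) ≡ inj₁ (fromℕ m)) where
  open Pairing P
  open PairingFacts P
  open Crossing posℕ (λ a b c d z → z) (λ a b c d z → z)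

  crossesLowerRow : ∀ i → 0 < toℕ i → toℕ i < m → Crosses X (inj₁ i) (inj₁ zero) ⇔ m < posℕ (partner (inj₁ i))
  crossesLowerRow i 0<i i<m = crossesBoundary (inj₁ i) (inj₁ zero) 0<i i<m refl (trans (cong posℕ sector) (FP.toℕ-fromℕ m)) notLast
    where
    notLast : posℕ (partner (inj₁ i)) ≢ m
    notLast e with partner-injective (inj₁ i) (inj₁ zero)
                     (trans (posℕ-injective _ _ (trans e (sym (FP.toℕ-fromℕ m)))) (sym sector))
    ... | refl = NP.<-irrefl refl 0<i

module Bracket (m : ℕ) (ρ : ℕ → ℕ) (ρ-involutive : ∀ d → d < suc m → ρ (ρ d) ≡ d)
               (ρ≢ : ∀ d → d < suc m → ρ d ≢ d) where

  L : ℕ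
  L = suc m

  partnerB : Pt L L → Pt L L
  partnerB (inj₁ i) with ρ (toℕ i) ℕ.<? L
  ... | yes p = inj₁ (fromℕ< p)
  ... | no _ = inj₂ i
  partnerB (inj₂ i) with ρ (toℕ i) ℕ.<? L
  ... | yes p = inj₂ (fromℕ< p)
  ... | no _ = inj₁ i

  lowerPartner : ∀ i → (Σ (ρ (toℕ i) < L) λ p → partnerB (inj₁ i) ≡ inj₁ (fromℕ< p))
                     ⊎ (L ≤ ρ (toℕ i) × partnerB (inj₁ i) ≡ inj₂ i)
  lowerPartner i with ρ (toℕ i) ℕ.<? L
  ... | yes p = inj₁ (p , refl)
  ... | no np = inj₂ (NP.≮⇒≥ np , refl)

  lowerPartner-outside : ∀ i → L ≤ ρ (toℕ i) → partnerB (inj₁ i) ≡ inj₂ i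
  lowerPartner-outside i le with lowerPartner i
  ... | inj₁ (p , _) = ⊥-elim (NP.<⇒≱ p le)
  ... | inj₂ (_ , e) = e

  partnerB-swap : ∀ x → partnerB (swap x) ≡ swap (partnerB x)
  partnerB-swap (inj₁ i) with ρ (toℕ i) ℕ.<? L
  ... | yes p = refl
  ... | no _ = refl
  partnerB-swap (inj₂ i) with ρ (toℕ i) ℕ.<? L
  ... | yes p = refl
  ... | no _ = refl

  upperPartner : ∀ {i z} → partnerB (inj₁ i) ≡ z → partnerB (inj₂ i) ≡ swap z
  upperPartner {i} e = trans (partnerB-swap (inj₁ i)) (cong swap e)

  lowerPartner⇔ : ∀ i j → inj₁ j ≡ partnerB (inj₁ i) ⇔ toℕ j ≡ ρ (toℕ i)
  lowerPartner⇔ i j with lowerPartner i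
  ... | inj₁ (p , e) rewrite e = mk⇔ (λ h → trans (cong toℕ (SP.inj₁-injective h)) (FP.toℕ-fromℕ< p))
                                      (λ h → cong inj₁ (FP.toℕ-injective (trans h (sym (FP.toℕ-fromℕ< p)))))
  ... | inj₂ (le , e) rewrite e = mk⇔ (λ ()) (λ h → ⊥-elim (NP.<⇒≱ (FP.toℕ<n j) (subst (L ≤_) (sym h) le)))

  partnerB≢ : ∀ x → partnerB x ≢ x
  partnerB≢ (inj₁ i) e = ρ≢ (toℕ i) (FP.toℕ<n i) (sym (to (lowerPartner⇔ i i) (sym e)))
  partnerB≢ (inj₂ i) e = partnerB≢ (inj₁ i) (trans (sym (SP.swap-involutive _)) (cong swap (trans (sym (partnerB-swap (inj₁ i))) e)))

  partnerB-involutive : ∀ x → partnerB (partnerB x) ≡ x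
  partnerB-involutive (inj₁ i) with lowerPartner i
  ... | inj₁ (p , e) rewrite e = sym (from (lowerPartner⇔ (fromℕ< p) i)
                                          (sym (trans (cong ρ (FP.toℕ-fromℕ< p)) (ρ-involutive (toℕ i) (FP.toℕ<n i)))))
  ... | inj₂ (_ , e) rewrite e = upperPartner e
  partnerB-involutive (inj₂ i) = begin
    partnerB (partnerB (swap (inj₁ i)))  ≡⟨ cong partnerB (partnerB-swap (inj₁ i)) ⟩
    partnerB (swap (partnerB (inj₁ i)))  ≡⟨ partnerB-swap (partnerB (inj₁ i)) ⟩
    swap (partnerB (partnerB (inj₁ i)))  ≡⟨ cong swap (partnerB-involutive (inj₁ i)) ⟩
    inj₂ i                                ∎
    where open ≡-Reasoning

  Br : (M : Vec Col L) → Part M M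
  Br M = involutionPart partnerB partnerB-involutive

  pairingBr : (M : Vec Col L) → Pairing (Br M)
  pairingBr M = involutionPairing partnerB partnerB-involutive partnerB≢

  module _ (M : Vec Col L) where
    open PairingFacts (pairingBr M)

    isPairBr : IsPairPart (Br M)
    isPairBr x = partnerB x , partnerB≢ x , λ z → ⇔.refl

    selfAdjointBr : Br M ≈ₚ (Br M *)
    selfAdjointBr x y = mk⇔ fw bw
      where
      swap-injective : ∀ {a b : Pt L L} → swap a ≡ swap b → a ≡ b
      swap-injective {a} {b} e = trans (sym (SP.swap-involutive a)) (trans (cong swap e) (SP.swap-involutive b))
      fw : y ≡ x ⊎ y ≡ partnerB x → swap y ≡ swap x ⊎ swap y ≡ partnerB (swap x)
      fw (inj₁ refl) = inj₁ refl
      fw (inj₂ refl) = inj₂ (sym (partnerB-swap x))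
      bw : swap y ≡ swap x ⊎ swap y ≡ partnerB (swap x) → y ≡ x ⊎ y ≡ partnerB x
      bw (inj₁ e) = inj₁ (swap-injective e)
      bw (inj₂ e) = inj₂ (swap-injective (trans e (partnerB-swap x)))

    columns-rel : ∀ {a b} → rel (Br M) a b → rel (Br M) (inj₁ (column a)) (inj₁ (column b))
    columns-rel (inj₁ refl) = inj₁ refl
    columns-rel {inj₁ i} (inj₂ refl) with lowerPartner i
    ... | inj₁ (p , e) = inj₂ (trans (cong (λ z → inj₁ (column z)) e) (sym e))
    ... | inj₂ (_ , e) = inj₁ (cong (λ z → inj₁ (column z)) e)
    columns-rel {inj₂ i} (inj₂ refl) with lowerPartner i
    ... | inj₁ (p , e) = inj₂ (trans (cong (λ z → inj₁ (column z)) (upperPartner e)) (sym e))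
    ... | inj₂ (_ , e) = inj₁ (cong (λ z → inj₁ (column z)) (upperPartner e))

    open Composition (Br M) (Br M)

    -- in Br M · Br M a point is joined to its partner, directly or through
    -- the middle point of its column
    joinedToPartner : ∀ x → Path (outer x) (outer (partnerB x))
    joinedToPartner (inj₁ i) with lowerPartner i
    ... | inj₁ (p , e) = subst (λ z → Path (inj₁ i) (outer z)) (sym e) (viaP {inj₁ i} {inj₁ (fromℕ< p)} (inj₂ (sym e)))
    ... | inj₂ (_ , e) = subst (λ z → Path (inj₁ i) (outer z)) (sym e) (throughColumn i e)
      where
      throughColumn : ∀ i → partnerB (inj₁ i) ≡ inj₂ i → Path (inj₁ i) (inj₂ (inj₂ i))
      throughColumn i e = viaP {inj₁ i} {inj₂ i} (inj₂ (sym e)) ◅◅ viaQ {inj₁ i} {inj₂ i} (inj₂ (sym e))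
    joinedToPartner (inj₂ i) with lowerPartner i
    ... | inj₁ (p , e) = subst (λ z → Path (outer (inj₂ i)) (outer z)) (sym (upperPartner e))
                           (viaQ {inj₂ i} {inj₂ (fromℕ< p)} (inj₂ (sym (upperPartner e))))
    ... | inj₂ (_ , e) = subst (λ z → Path (outer (inj₂ i)) (outer z)) (sym (upperPartner e))
                           (reverse (subst (λ z → Path (inj₁ i) (outer z)) e (joinedToPartner (inj₁ i))))

    -- Br M · Br M = Br M: folding the middle row onto the lower row (and
    -- keeping the outer rows) maps connected points to related ones.
    idempotentBr : (Br M · Br M) ≈ₚ Br M
    idempotentBr x y = mk⇔ (λ c → subst₂ (rel (Br M)) (fold-outer x) (fold-outer y)
                                     (invariant (equiv (Br M)) fold onFirst onSecond x y c))
                           joined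
      where
      fold : Pt3 L L L → Pt L L
      fold (inj₁ i) = inj₁ i
      fold (inj₂ (inj₁ j)) = inj₁ j
      fold (inj₂ (inj₂ i)) = inj₂ i
      fold-outer : ∀ x → fold (outer x) ≡ x
      fold-outer (inj₁ i) = refl
      fold-outer (inj₂ i) = refl
      fold-embP : ∀ a → fold (embP a) ≡ inj₁ (column a)
      fold-embP (inj₁ i) = refl
      fold-embP (inj₂ i) = refl
      onFirst : ∀ a b → rel (Br M) a b → rel (Br M) (fold (embP a)) (fold (embP b))
      onFirst a b r = subst₂ (rel (Br M)) (sym (fold-embP a)) (sym (fold-embP b)) (columns-rel r)
      onSecond : ∀ a b → rel (Br M) a b → rel (Br M) (fold (embQ a)) (fold (embQ b))
      onSecond (inj₁ _) (inj₁ _) r = r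
      onSecond (inj₁ _) (inj₂ _) r = r
      onSecond (inj₂ _) (inj₁ _) r = r
      onSecond (inj₂ _) (inj₂ _) r = r
      joined : rel (Br M) x y → Path (outer x) (outer y)
      joined (inj₁ refl) = ε
      joined (inj₂ refl) = joinedToPartner x

    -- ρ 0 = m says that the ends of the lower row are paired.
    module _ (ρ0 : ρ 0 ≡ m) where

      partnerB-first : partnerB (inj₁ zero) ≡ inj₁ (fromℕ m)
      partnerB-first = sym (from (lowerPartner⇔ zero (fromℕ m)) (trans (FP.toℕ-fromℕ m) (sym ρ0)))

      sectorBr : IsSector (Br M) (lowerRow m)
      sectorBr = subst₂ (IsBlock2 (Br M)) (sym (ptAt-lowerRow m zero refl)) (sym (ptAt-lowerRow m (fromℕ m) (FP.toℕ-fromℕ m)))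
                   (from (block⇔partner _ _) (sym partnerB-first))

      crossesBr : ∀ i → 2 + i < L → Crosses (Br M) (ptAt (lowerRow m) (suc i)) (ptAt (lowerRow m) 0) ⇔ L ≤ ρ (suc i)
      crossesBr i h =
        ⇔.trans (⇔-cong₂ (Crosses (Br M)) (ptAt-lowerRow m x (FP.toℕ-fromℕ< x<L)) (ptAt-lowerRow m zero refl))
          (⇔.trans (LowerRowCrossing.crossesLowerRow (pairingBr M) partnerB-first x 0<x x<m)
            (subst (λ d → m < posℕ (partnerB (inj₁ x)) ⇔ L ≤ ρ d) (FP.toℕ-fromℕ< x<L) beyond))
        where
        x<L : suc i < L
        x<L = NP.<-trans (NP.n<1+n (suc i)) h
        x : Fin L
        x = fromℕ< x<L
        0<x : 0 < toℕ x
        0<x = subst (0 <_) (sym (FP.toℕ-fromℕ< x<L)) (s≤s z≤n)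
        x<m : toℕ x < m
        x<m = subst (_< m) (sym (FP.toℕ-fromℕ< x<L)) (ℕ.s<s⁻¹ h)
        beyond : m < posℕ (partnerB (inj₁ x)) ⇔ L ≤ ρ (toℕ x)
        beyond with lowerPartner x
        ... | inj₁ (p , e) = mk⇔ (λ lt → ⊥-elim (NP.<⇒≱ (FP.toℕ<n (fromℕ< p)) (subst (λ z → m < posℕ z) e lt)))
                                  (λ le → ⊥-elim (NP.<⇒≱ p le))
        ... | inj₂ (le , e) = mk⇔ (λ _ → le) (λ _ → subst (λ z → m < posℕ z) (sym e) (NP.<-≤-trans (NP.n<1+n m) (posℕ-upper x)))

    blocksBr : ∀ i j → 2 + i < L → 2 + j < L →
               IsBlock2 (Br M) (ptAt (lowerRow m) (suc i)) (ptAt (lowerRow m) (suc j)) ⇔ suc j ≡ ρ (suc i)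
    blocksBr i j hi hj =
      ⇔.trans (⇔-cong₂ (IsBlock2 (Br M)) (ptAt-lowerRow m x (FP.toℕ-fromℕ< x<L)) (ptAt-lowerRow m y (FP.toℕ-fromℕ< y<L)))
        (⇔.trans (block⇔partner (inj₁ x) (inj₁ y))
          (subst₂ (λ a b → inj₁ y ≡ partnerB (inj₁ x) ⇔ a ≡ ρ b) (FP.toℕ-fromℕ< y<L) (FP.toℕ-fromℕ< x<L) (lowerPartner⇔ x y)))
      where
      x<L : suc i < L
      x<L = NP.<-trans (NP.n<1+n (suc i)) hi
      y<L : suc j < L
      y<L = NP.<-trans (NP.n<1+n (suc j)) hj
      x y : Fin L
      x = fromℕ< x<L
      y = fromℕ< y<L

    module _ (C : ℕ → Col) (colM : ∀ i → lookup M i ≡ C (toℕ i))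
             (Cρ : ∀ d → d < L → ρ d < L → C (ρ d) ≡ inv (C d)) where

      ncol-partnerB : ∀ x → ncol M M (partnerB x) ≡ inv (ncol M M x)
      ncol-partnerB (inj₁ i) with lowerPartner i
      ... | inj₁ (p , e) = begin
        ncol M M (partnerB (inj₁ i))  ≡⟨ cong (ncol M M) e ⟩
        lookup M (fromℕ< p)           ≡⟨ colM _ ⟩
        C (toℕ (fromℕ< p))            ≡⟨ cong C (FP.toℕ-fromℕ< p) ⟩
        C (ρ (toℕ i))                 ≡⟨ Cρ _ (FP.toℕ<n i) p ⟩
        inv (C (toℕ i))               ≡⟨ cong inv (colM i) ⟨
        inv (lookup M i)              ∎
        where open ≡-Reasoning
      ... | inj₂ (_ , e) = cong (ncol M M) e
      ncol-partnerB (inj₂ i) = begin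
        ncol M M (partnerB (swap (inj₁ i)))         ≡⟨ cong (ncol M M) (partnerB-swap (inj₁ i)) ⟩
        ncol M M (swap (partnerB (inj₁ i)))         ≡⟨ ncol-swap M M (swap (partnerB (inj₁ i))) ⟩
        inv (ncol M M (swap (swap (partnerB (inj₁ i))))) ≡⟨ cong (λ z → inv (ncol M M z)) (SP.swap-involutive (partnerB (inj₁ i))) ⟩
        inv (ncol M M (partnerB (inj₁ i)))          ≡⟨ cong inv (ncol-partnerB (inj₁ i)) ⟩
        inv (inv (lookup M i))                      ∎
        where open ≡-Reasoning

      p2nbBr : P2nb (Br M)
      p2nbBr = isPairBr , λ x y _ b → σ-pair x y (to (block⇔partner x y) b)
        where
        val-inv : ∀ c → val c +ℤ (val (inv c) +ℤ 0ℤ) ≡ 0ℤ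
        val-inv white = refl
        val-inv black = refl
        σ-pair : ∀ x y → y ≡ partnerB x → σ M M (x ∷ y ∷ []) ≡ 0ℤ
        σ-pair x y refl = subst (λ c → val (ncol M M x) +ℤ (val c +ℤ 0ℤ) ≡ 0ℤ) (sym (ncol-partnerB x)) (val-inv (ncol M M x))

      isBracketBr : ρ 0 ≡ m → IsBracket (Br M)
      isBracketBr ρ0 = p2nbBr , selfAdjointBr , idempotentBr , sectorBr ρ0

  -- Doubling: if the blocks of r are the pairs {d , ρ d} of cyclic positions
  -- and the lower row of r is M, then r r* = Br M.  A middle point at position
  -- d is joined either to the lower point ρ d (and the upper point ρ d), or
  -- only to the middle point at ρ d.
  module Doubling {lr} (ρ< : ∀ d → d < L + lr → ρ d < L + lr) (ρ-involutive' : ∀ d → d < L + lr → ρ (ρ d) ≡ d)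
                  {M : Vec Col L} {up : Vec Col lr} (r : Part M up)
                  (rel-r : ∀ a b → rel r a b ⇔ (posℕ b ≡ posℕ a ⊎ posℕ b ≡ ρ (posℕ a))) where

    Class : Set
    Class = Pt L L ⊎ ℕ

    _≈_ : Class → Class → Set
    _≈_ = Pointwise (rel (Br M)) _≡_

    ≈-isEquivalence : IsEquivalence _≈_
    ≈-isEquivalence = ⊎-isEquivalence (equiv (Br M)) isEquivalence

    middle : ℕ → Class
    middle d with ρ d ℕ.<? L
    ... | yes p = inj₁ (inj₁ (fromℕ< p))
    ... | no _ = inj₂ (d ⊓ ρ d)

    middle-inside : ∀ d (p : ρ d < L) → middle d ≡ inj₁ (inj₁ (fromℕ< p))
    middle-inside d p with ρ d ℕ.<? L
    ... | yes q = cong (λ z → inj₁ (inj₁ z)) (FP.toℕ-injective (trans (FP.toℕ-fromℕ< q) (sym (FP.toℕ-fromℕ< p))))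
    ... | no nq = ⊥-elim (nq p)

    middle-outside : ∀ d → L ≤ ρ d → middle d ≡ inj₂ (d ⊓ ρ d)
    middle-outside d le with ρ d ℕ.<? L
    ... | yes q = ⊥-elim (NP.<⇒≱ q le)
    ... | no _ = refl

    -- the class of a point of r, its lower row placed in the row given by s
    classify : (Fin L → Pt L L) → Pt L lr → Class
    classify s (inj₁ i) = inj₁ (s i)
    classify s (inj₂ j) = middle (posℕ {L} {lr} (inj₂ j))

    classify-rel : (s : Fin L → Pt L L) →
                   (∀ i i' → toℕ i' ≡ ρ (toℕ i) → rel (Br M) (s i) (s i')) →
                   (∀ i → L ≤ ρ (toℕ i) → rel (Br M) (s i) (inj₁ i)) →
                   ∀ a b → rel r a b → classify s a ≈ classify s b
    classify-rel s internal through a b r with to (rel-r a b) r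
    ... | inj₁ e rewrite posℕ-injective b a e = IsEquivalence.refl ≈-isEquivalence
    ... | inj₂ e = paired a b e
      where
      lowerUpper : ∀ i j → posℕ {L} {lr} (inj₂ j) ≡ ρ (toℕ i) → classify s (inj₁ i) ≈ classify s (inj₂ j)
      lowerUpper i j e = subst (inj₁ (s i) ≈_) (sym (middle-inside _ back<L))
                           (SumPW.inj₁ (subst (rel (Br M) (s i) ∘ inj₁) (FP.toℕ-injective (sym (trans (FP.toℕ-fromℕ< back<L) back)))
                                          (through i (subst (L ≤_) e (posℕ-upper j)))))
        where
        back : ρ (posℕ {L} {lr} (inj₂ j)) ≡ toℕ i
        back = trans (cong ρ e) (ρ-involutive (toℕ i) (FP.toℕ<n i))
        back<L : ρ (posℕ {L} {lr} (inj₂ j)) < L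
        back<L = subst (_< L) (sym back) (FP.toℕ<n i)
      paired : ∀ a b → posℕ b ≡ ρ (posℕ a) → classify s a ≈ classify s b
      paired (inj₁ i) (inj₁ i') e = SumPW.inj₁ (internal i i' e)
      paired (inj₁ i) (inj₂ j) e = lowerUpper i j e
      paired (inj₂ j) (inj₁ i) e = IsEquivalence.sym ≈-isEquivalence (lowerUpper i j (trans (sym (ρ-involutive' _ (posℕ< (inj₂ j)))) (cong ρ (sym e))))
      paired (inj₂ j) (inj₂ j') e = subst₂ _≈_ (sym (middle-outside d outside)) (sym (middle-outside (posℕ (inj₂ j')) outside'))
                                       (SumPW.inj₂ (trans (NP.⊓-comm d (ρ d)) (cong₂ _⊓_ (sym e) (trans (sym (ρ-involutive' d (posℕ< (inj₂ j)))) (cong ρ (sym e))))))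
        where
        d = posℕ {L} {lr} (inj₂ j)
        outside : L ≤ ρ d
        outside = subst (L ≤_) e (posℕ-upper j')
        outside' : L ≤ ρ (posℕ {L} {lr} (inj₂ j'))
        outside' = subst (L ≤_) (trans (sym (ρ-involutive' d (posℕ< (inj₂ j)))) (cong ρ (sym e))) (posℕ-upper j)

    open Composition r (r *)

    threeRows : Pt3 L lr L → Class
    threeRows (inj₁ i) = inj₁ (inj₁ i)
    threeRows (inj₂ (inj₁ j)) = middle (posℕ {L} {lr} (inj₂ j))
    threeRows (inj₂ (inj₂ i)) = inj₁ (inj₂ i)

    toPartner : ∀ x → Path (outer x) (outer (partnerB x))
    toPartner (inj₁ i) with lowerPartner i
    ... | inj₁ (p , e) = subst (λ z → Path (inj₁ i) (outer z)) (sym e)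
                           (viaP {inj₁ i} {inj₁ (fromℕ< p)} (from (rel-r _ _) (inj₂ (FP.toℕ-fromℕ< p))))
    ... | inj₂ (le , e) = subst (λ z → Path (inj₁ i) (outer z)) (sym e) (throughMiddle i le)
      where
      throughMiddle : ∀ i → L ≤ ρ (toℕ i) → Path (inj₁ i) (inj₂ (inj₂ i))
      throughMiddle i le with upperAt {L} {lr} (ρ (toℕ i)) le (ρ< _ (NP.<-≤-trans (FP.toℕ<n i) (NP.m≤m+n L lr)))
      ... | j , ej = viaP {inj₁ i} {inj₂ j} (from (rel-r _ _) (inj₂ ej))
                   ◅◅ viaQ {inj₁ j} {inj₂ i} (from (rel-r (inj₂ j) (inj₁ i)) (inj₂ (sym (trans (cong ρ ej) (ρ-involutive (toℕ i) (FP.toℕ<n i))))))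
    toPartner (inj₂ i) with lowerPartner i
    ... | inj₁ (p , e) = subst (λ z → Path (outer (inj₂ i)) (outer z)) (sym (upperPartner e))
                           (viaQ {inj₂ i} {inj₂ (fromℕ< p)} (from (rel-r (inj₁ i) (inj₁ (fromℕ< p))) (inj₂ (FP.toℕ-fromℕ< p))))
    ... | inj₂ (le , e) = subst (λ z → Path (outer (inj₂ i)) (outer z)) (sym (upperPartner e))
                            (reverse (subst (λ z → Path (inj₁ i) (outer z)) e (toPartner (inj₁ i))))

    doubling : (r · (r *)) ≈ₚ Br M
    doubling x y = mk⇔ (λ c → unclass x y (invariant ≈-isEquivalence threeRows onR onR* x y c)) joined
      where
      onR : ∀ a b → rel r a b → threeRows (embP a) ≈ threeRows (embP b)
      onR a b r = subst₂ _≈_ (embP-class a) (embP-class b) (classify-rel inj₁ (λ i i' e → inj₂ (from (lowerPartner⇔ i i') e)) (λ i _ → inj₁ refl) a b r)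
        where
        embP-class : ∀ a → classify inj₁ a ≡ threeRows (embP a)
        embP-class (inj₁ i) = refl
        embP-class (inj₂ j) = refl
      onR* : ∀ a b → rel (r *) a b → threeRows (embQ a) ≈ threeRows (embQ b)
      onR* a b r = subst₂ _≈_ (embQ-class a) (embQ-class b) (classify-rel inj₂ internal₂ through₂ (swap a) (swap b) r)
        where
        embQ-class : ∀ a → classify inj₂ (swap a) ≡ threeRows (embQ a)
        embQ-class (inj₁ j) = refl
        embQ-class (inj₂ i) = refl
        internal₂ : ∀ i i' → toℕ i' ≡ ρ (toℕ i) → rel (Br M) (inj₂ i) (inj₂ i')
        internal₂ i i' e = inj₂ (trans (cong swap (from (lowerPartner⇔ i i') e)) (sym (partnerB-swap (inj₁ i))))
        through₂ : ∀ i → L ≤ ρ (toℕ i) → rel (Br M) (inj₂ i) (inj₁ i)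
        through₂ i le = inj₂ (sym (upperPartner (lowerPartner-outside i le)))
      unclass : ∀ x y → threeRows (outer x) ≈ threeRows (outer y) → rel (Br M) x y
      unclass (inj₁ _) (inj₁ _) (SumPW.inj₁ r) = r
      unclass (inj₁ _) (inj₂ _) (SumPW.inj₁ r) = r
      unclass (inj₂ _) (inj₁ _) (SumPW.inj₁ r) = r
      unclass (inj₂ _) (inj₂ _) (SumPW.inj₁ r) = r
      joined : rel (Br M) x y → Path (outer x) (outer y)
      joined (inj₁ refl) = ε
      joined (inj₂ refl) = toPartner x

-- The pairing of p₀ read in the coordinates of a sector S: the point at
-- position d of S (continued cyclically) is P d, and ρ d is the position of
-- its partner.
module SectorCoordinates {k₀ l₀} {lo₀ : Vec Col k₀} {up₀ : Vec Col l₀} (p₀ : Part lo₀ up₀) (P2 : P2nb p₀)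
                         (S : Interval (k₀ + l₀)) (sec : IsSector p₀ S) where

  n : ℕ
  n = ℕ.pred (k₀ + l₀)

  size₀ : k₀ + l₀ ≡ suc n
  size₀ = sym (NP.suc-pred (k₀ + l₀) {{ℕ.>-nonZero (NP.<-trans (0<len S) (len<n S))}})

  N st L : ℕ
  N = suc n
  st = toℕ (start S)
  L = len S

  st<N : st < N
  st<N = subst (st <_) size₀ (FP.toℕ<n (start S))

  L<N : L < N
  L<N = subst (L <_) size₀ (len<n S)

  posℕ<N : ∀ (z : Pt k₀ l₀) → posℕ z < N
  posℕ<N z = subst (posℕ z <_) size₀ (posℕ< z)

  P : ℕ → Pt k₀ l₀
  P d = ptAt S d

  C : ℕ → Col
  C d = ncol lo₀ up₀ (P d)

  %-absorbʳ : ∀ a b → (a + b % N) % N ≡ (a + b) % N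
  %-absorbʳ a b = trans (%-distribˡ-+ a (b % N) N) (trans (cong (λ z → (a % N + z) % N) (m%n%n≡m%n b N)) (sym (%-distribˡ-+ a b N)))

  %-absorbˡ : ∀ a b → (a % N + b) % N ≡ (a + b) % N
  %-absorbˡ a b = trans (cong (_% N) (NP.+-comm (a % N) b)) (trans (%-absorbʳ b a) (cong (_% N) (NP.+-comm b a)))

  posℕ-P : ∀ d → posℕ (P d) ≡ (st + d) % N
  posℕ-P d = trans (posℕ-atPos {k₀} {l₀} (shift (start S) d)) (toℕ-shift (start S) size₀)
    where
    toℕ-shift : ∀ {K} (a : Fin K) → K ≡ suc n → toℕ (shift a d) ≡ (toℕ a + d) % suc n
    toℕ-shift a refl = FP.toℕ-fromℕ< _

  coord : Pt k₀ l₀ → ℕ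
  coord z = (posℕ z + (N ∸ st)) % N

  coord< : ∀ z → coord z < N
  coord< z = m%n<n (posℕ z + (N ∸ st)) N

  shiftedBack : ∀ a → (a + st + (N ∸ st)) % N ≡ a % N
  shiftedBack a = begin
    (a + st + (N ∸ st)) % N   ≡⟨ cong (_% N) (NP.+-assoc a st _) ⟩
    (a + (st + (N ∸ st))) % N ≡⟨ cong (λ w → (a + w) % N) (NP.m+[n∸m]≡n (NP.<⇒≤ st<N)) ⟩
    (a + N) % N               ≡⟨ [m+n]%n≡m%n a N ⟩
    a % N                     ∎
    where open ≡-Reasoning

  P-coord : ∀ z → P (coord z) ≡ z
  P-coord z = atPos-posℕ (shift (start S) (coord z)) z (begin
    toℕ (shift (start S) (coord z))       ≡⟨ trans (sym (posℕ-atPos {k₀} {l₀} (shift (start S) (coord z)))) (posℕ-P (coord z)) ⟩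
    (st + (posℕ z + (N ∸ st)) % N) % N   ≡⟨ %-absorbʳ st _ ⟩
    (st + (posℕ z + (N ∸ st))) % N       ≡⟨ cong (_% N) (trans (sym (NP.+-assoc st (posℕ z) _)) (cong (_+ (N ∸ st)) (NP.+-comm st (posℕ z)))) ⟩
    (posℕ z + st + (N ∸ st)) % N         ≡⟨ shiftedBack (posℕ z) ⟩
    posℕ z % N                           ≡⟨ m<n⇒m%n≡m (posℕ<N z) ⟩
    posℕ z                               ∎)
    where open ≡-Reasoning

  coord-P : ∀ d → d < N → coord (P d) ≡ d
  coord-P d dN = begin
    (posℕ (P d) + (N ∸ st)) % N     ≡⟨ cong (λ w → (w + (N ∸ st)) % N) (posℕ-P d) ⟩
    ((st + d) % N + (N ∸ st)) % N   ≡⟨ %-absorbˡ (st + d) _ ⟩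
    (st + d + (N ∸ st)) % N         ≡⟨ cong (λ w → (w + (N ∸ st)) % N) (NP.+-comm st d) ⟩
    (d + st + (N ∸ st)) % N         ≡⟨ shiftedBack d ⟩
    d % N                           ≡⟨ m<n⇒m%n≡m dN ⟩
    d                               ∎
    where open ≡-Reasoning

  P-injective : ∀ d e → d < N → e < N → P d ≡ P e → d ≡ e
  P-injective d e dN eN h = trans (sym (coord-P d dN)) (trans (cong coord h) (coord-P e eN))

  open Pairing (pairing p₀ (proj₁ P2))
  open PairingFacts (pairing p₀ (proj₁ P2))

  ρ : ℕ → ℕ
  ρ d = coord (partner (P d))

  ρ< : ∀ d → ρ d < N
  ρ< d = coord< (partner (P d))

  P-ρ : ∀ d → P (ρ d) ≡ partner (P d)
  P-ρ d = P-coord (partner (P d))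

  ρ-involutive : ∀ d → d < N → ρ (ρ d) ≡ d
  ρ-involutive d dN = trans (cong (λ z → coord (partner z)) (P-ρ d)) (trans (cong coord (partner-involutive (P d))) (coord-P d dN))

  ρ≢ : ∀ d → d < N → ρ d ≢ d
  ρ≢ d dN e = partner≢ (P d) (trans (sym (P-ρ d)) (cong P e))

  rel-P : ∀ d e → d < N → e < N → rel p₀ (P d) (P e) ⇔ (e ≡ d ⊎ e ≡ ρ d)
  rel-P d e dN eN = ⇔.trans (rel⇔partner (P d) (P e)) (mk⇔ fw bw)
    where
    fw : P e ≡ P d ⊎ P e ≡ partner (P d) → e ≡ d ⊎ e ≡ ρ d
    fw (inj₁ h) = inj₁ (P-injective e d eN dN h)
    fw (inj₂ h) = inj₂ (trans (sym (coord-P e eN)) (cong coord h))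
    bw : e ≡ d ⊎ e ≡ ρ d → P e ≡ P d ⊎ P e ≡ partner (P d)
    bw (inj₁ refl) = inj₁ refl
    bw (inj₂ refl) = inj₂ (P-ρ d)

  -- blocks of p₀ are neutral, so ρ inverts normalised colours
  C-ρ : ∀ d → C (ρ d) ≡ inv (C d)
  C-ρ d = trans (cong (ncol lo₀ up₀) (P-ρ d))
                (neutral _ _ (proj₂ P2 (P d) (partner (P d)) (λ e → partner≢ (P d) (sym e)) (rel⇔partner (P d))))
    where
    neutral : ∀ c c' → val c +ℤ (val c' +ℤ 0ℤ) ≡ 0ℤ → c' ≡ inv c
    neutral white white ()
    neutral white black _ = refl
    neutral black white _ = refl
    neutral black black ()

  m : ℕ
  m = ℕ.pred L

  L≡ : L ≡ suc m
  L≡ = sym (NP.suc-pred L {{ℕ.>-nonZero (0<len S)}})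

  m<N : m < N
  m<N = NP.<-trans (subst (m <_) (sym L≡) (NP.n<1+n m)) L<N

  0<N : 0 < N
  0<N = s≤s z≤n

  -- S is a sector: the ends of S are paired
  ρ0 : ρ 0 ≡ m
  ρ0 = sym (P-injective m (ρ 0) m<N (ρ< 0) (trans (to (block⇔partner (P 0) (P (L ∸ 1))) sec) (sym (P-ρ 0))))

  ρm : ρ m ≡ 0
  ρm = trans (cong ρ (sym ρ0)) (ρ-involutive 0 0<N)

  -- coord shifts positions cyclically, so it respects the cyclic order
  open CyclicShift n using (cyclic-shiftBy)

  crossesP : ∀ i → 2 + i < L → Crosses p₀ (P (suc i)) (P 0) ⇔ L ≤ ρ (suc i)
  crossesP i h = ⇔.trans (crossesBoundary (P (suc i)) (P 0) 0<x x<m (coord-P 0 0<N) ρ0 notEnd)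
                         (mk⇔ (subst (_≤ ρ (suc i)) (sym L≡)) (subst (_≤ ρ (suc i)) L≡))
    where
    open Crossing coord (λ a b c d z → to (cyclic-shiftBy (N ∸ st) (posℕ<N a) (posℕ<N b) (posℕ<N c) (posℕ<N d)) z)
                        (λ a b c d z → from (cyclic-shiftBy (N ∸ st) (posℕ<N a) (posℕ<N b) (posℕ<N c) (posℕ<N d)) z)
    si<m : suc i < m
    si<m = ℕ.s<s⁻¹ (subst (2 + i <_) L≡ h)
    siN : suc i < N
    siN = NP.<-trans si<m m<N
    0<x : 0 < coord (P (suc i))
    0<x = subst (0 <_) (sym (coord-P (suc i) siN)) (s≤s z≤n)
    x<m : coord (P (suc i)) < m
    x<m = subst (_< m) (sym (coord-P (suc i) siN)) si<m
    notEnd : coord (partner (P (suc i))) ≢ m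
    notEnd e = NP.0≢1+n (sym (trans (sym (ρ-involutive (suc i) siN)) (trans (cong ρ e) ρm)))

  blocksP : ∀ i j → 2 + j < L → IsBlock2 p₀ (P (suc i)) (P (suc j)) ⇔ suc j ≡ ρ (suc i)
  blocksP i j hj = ⇔.trans (block⇔partner (P (suc i)) (P (suc j)))
                           (mk⇔ (λ e → trans (sym (coord-P (suc j) sjN)) (cong coord e)) (λ e → trans (cong P e) (P-ρ (suc i))))
    where
    sjN : suc j < N
    sjN = NP.<-trans (NP.<-trans (NP.n<1+n _) hj) L<N

  open RotatedCopies p₀ n size₀ using (Copy; copy; pt; toℕ-index; copyWithLowerRow)

  pt-P : ∀ d → pt (st + d) ≡ P d
  pt-P d = cong atPos (FP.toℕ-injective (trans (toℕ-index (st + d)) (trans (sym (posℕ-P d)) (posℕ-atPos {k₀} {l₀} _))))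

  vec-ext : ∀ {k} (u v : Vec Col k) → (∀ i → lookup u i ≡ lookup v i) → u ≡ v
  vec-ext u v h = trans (sym (VP.tabulate∘lookup u)) (trans (VP.tabulate-cong h) (VP.tabulate∘lookup v))

  module OfLength (m' : ℕ) (eL : L ≡ suc m') where

    inS : ∀ {d} → d < suc m' → d < N
    inS {d} p = NP.<-trans (subst (d <_) (sym eL) p) L<N

    open Bracket m' ρ (λ d p → ρ-involutive d (inS p)) (λ d p → ρ≢ d (inS p)) public hiding (L)

    ρ0' : ρ 0 ≡ m'
    ρ0' = trans ρ0 (NP.suc-injective (trans (sym L≡) eL))

    -- Br M = r r* for the rotated copy r of p₀ whose lower row is S.
    member : ∀ (M : Vec Col (suc m')) → (∀ i → lookup M i ≡ C (toℕ i)) → ⟨ p₀ ⟩ (Br M)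
    member M colM with copyWithLowerRow st (suc m') (subst (_≤ N) eL (NP.<⇒≤ L<N))
    ... | l , copy lo up r member-r sz rel-shifted ncol-shifted =
      subst (λ v → ⟨ p₀ ⟩ (Br v)) lo≡M (resp (Doubling.doubling ρ<' ρ-involutive' r rel-r) (comp member-r (invol member-r)))
      where
      inN : ∀ {d} → d < suc m' + l → d < N
      inN {d} = subst (d <_) sz
      ρ<' : ∀ d → d < suc m' + l → ρ d < suc m' + l
      ρ<' d _ = subst (ρ d <_) (sym sz) (ρ< d)
      ρ-involutive' : ∀ d → d < suc m' + l → ρ (ρ d) ≡ d
      ρ-involutive' d p = ρ-involutive d (inN p)
      rel-r : ∀ a b → rel r a b ⇔ (posℕ b ≡ posℕ a ⊎ posℕ b ≡ ρ (posℕ a))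
      rel-r a b = ⇔.trans (rel-shifted a b) (⇔.trans (⇔-cong₂ (rel p₀) (pt-P (posℕ a)) (pt-P (posℕ b)))
                                                    (rel-P (posℕ a) (posℕ b) (inN (posℕ< a)) (inN (posℕ< b))))
      lo≡M : lo ≡ M
      lo≡M = vec-ext lo M (λ i → trans (ncol-shifted (inj₁ i)) (trans (cong (ncol lo₀ up₀) (pt-P (toℕ i))) (sym (colM i))))

    equivalent : ∀ (M : Vec Col (suc m')) → (∀ i → lookup M i ≡ C (toℕ i)) → SecEquiv p₀ S (Br M) (lowerRow m')
    equivalent M colM = record
      { sameSize = eL
      ; sameCols = λ i i<L → sym (trans (cong (ncol M M) (ptAt-lowerRow m' (fromℕ< (inRow i<L)) (FP.toℕ-fromℕ< (inRow i<L))))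
                                        (trans (colM _) (cong C (FP.toℕ-fromℕ< (inRow i<L)))))
      ; sameCross = λ i h → ⇔.trans (crossesP i h) (⇔.trans (mk⇔ (subst (_≤ ρ (suc i)) eL) (subst (_≤ ρ (suc i)) (sym eL)))
                                                         (⇔.sym (crossesBr M ρ0' i (inRow h))))
      ; sameBlock = λ i j hi hj → ⇔.trans (blocksP i j hj) (⇔.sym (blocksBr M i j (inRow hi) (inRow hj)))
      }
      where
      inRow : ∀ {d} → d < L → d < suc m'
      inRow {d} = subst (d <_) eL

    -- The partner of a lower point of q is determined by the data of (p₀ , S):
    -- the ends of the lower row are paired (sector); an interior point whose
    -- block does not cross ∂S has its partner inside the row, given by the
    -- block data; one whose block crosses has an upper partner, which q = q*
    -- and qq = q force to be the point above it.  Upper points follow by q = q*.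
    module Unique {M' : Vec Col (suc m')} (q : Part M' M') (isB : IsBracket q) (se : SecEquiv p₀ S q (lowerRow m')) where
      open SecEquiv se
      module Q = Pairing (pairing q (proj₁ (proj₁ isB)))
      module QF = PairingFacts (pairing q (proj₁ (proj₁ isB)))

      selfAdjoint : q ≈ₚ (q *)
      selfAdjoint = proj₁ (proj₂ isB)

      idempotent : (q · q) ≈ₚ q
      idempotent = proj₁ (proj₂ (proj₂ isB))

      m'<L' : m' < suc m'
      m'<L' = NP.n<1+n m'

      inRow : ∀ {d} → d < suc m' → d < L
      inRow {d} = subst (d <_) (sym eL)

      colours : ∀ i → lookup M' i ≡ C (toℕ i)
      colours i = sym (trans (sameCols (toℕ i) (inRow (FP.toℕ<n i))) (cong (ncol M' M') (ptAt-lowerRow m' i refl)))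

      firstQ : Q.partner (inj₁ zero) ≡ inj₁ (fromℕ m')
      firstQ = sym (to (QF.block⇔partner _ _)
                 (subst₂ (IsBlock2 q) (ptAt-lowerRow m' zero refl) (ptAt-lowerRow m' (fromℕ m') (FP.toℕ-fromℕ m')) (proj₂ (proj₂ (proj₂ isB)))))

      throughString : ∀ i j → rel q (inj₁ i) (inj₂ j) → Q.partner (inj₁ i) ≡ inj₂ i
      throughString i j r = sym (QF.related-partner (inj₁ i) (inj₂ i)
                              (to (idempotent (inj₁ i) (inj₂ i)) (viaP {inj₁ i} {inj₂ j} r ◅◅ viaQ {inj₁ j} {inj₂ i} r'))
                              (λ ()))
        where
        open Composition q q
        r' : rel q (inj₁ j) (inj₂ i)
        r' = IsEquivalence.sym (equiv q) {inj₂ i} {inj₁ j} (from (selfAdjoint (inj₂ i) (inj₁ j)) r)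

      crossingQ : ∀ i i' → toℕ i ≡ suc i' → suc i' < m' → L ≤ ρ (suc i') ⇔ m' < posℕ (Q.partner (inj₁ i))
      crossingQ i i' ei i<m = ⇔.trans (⇔.sym (crossesP i' h))
                                (⇔.trans (sameCross i' h)
                                  (⇔.trans (⇔-cong₂ (Crosses q) (ptAt-lowerRow m' i ei) (ptAt-lowerRow m' zero refl))
                                    (LowerRowCrossing.crossesLowerRow (pairing q (proj₁ (proj₁ isB))) firstQ i
                                      (subst (0 <_) (sym ei) (s≤s z≤n)) (subst (_< m') (sym ei) i<m))))
        where
        h : 2 + i' < L
        h = inRow (s≤s i<m)

      outside : ∀ i i' → toℕ i ≡ suc i' → suc i' < m' → L ≤ ρ (toℕ i) ⇔ m' < posℕ (Q.partner (inj₁ i))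
      outside i i' ei i<m = subst (λ d → L ≤ ρ d ⇔ m' < posℕ (Q.partner (inj₁ i))) (sym ei) (crossingQ i i' ei i<m)

      notEnd : ∀ i j → 0 < toℕ i → toℕ i < m' → Q.partner (inj₁ i) ≡ inj₁ j → 0 < toℕ j × toℕ j < m'
      notEnd i j 0<i i<m e = NP.≤∧≢⇒< z≤n (λ 0≡j → NP.<-irrefl (endFirst (sym 0≡j)) i<m)
                           , NP.≤∧≢⇒< (ℕ.s≤s⁻¹ (FP.toℕ<n j)) (λ j≡m → NP.<-irrefl (sym (endLast j≡m)) 0<i)
        where
        endFirst : toℕ j ≡ 0 → toℕ i ≡ m'
        endFirst j0 = begin
          toℕ i           ≡⟨ cong [ toℕ , toℕ ]′ (trans (sym (Q.partner-involutive (inj₁ i)))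
                                                     (trans (cong Q.partner (trans e (cong inj₁ (FP.toℕ-injective j0)))) firstQ)) ⟩
          toℕ (fromℕ m')  ≡⟨ FP.toℕ-fromℕ m' ⟩
          m'              ∎
          where open ≡-Reasoning
        endLast : toℕ j ≡ m' → toℕ i ≡ 0
        endLast jm = cong [ toℕ , toℕ ]′ (QF.partner-injective _ _ (trans e (trans jLast (sym firstQ))))
          where
          jLast : inj₁ j ≡ inj₁ (fromℕ m')
          jLast = cong inj₁ (FP.toℕ-injective (trans jm (sym (FP.toℕ-fromℕ m'))))

      partnerQ-interior : ∀ i i' → toℕ i ≡ suc i' → suc i' < m' → Q.partner (inj₁ i) ≡ partnerB (inj₁ i)
      partnerQ-interior i i' ei i<m = byCases (lowerPartner i) (Q.partner (inj₁ i)) refl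
        where
        0<i : 0 < toℕ i
        0<i = subst (0 <_) (sym ei) (s≤s z≤n)
        -- inside the row, the partner is fixed by the block data
        sameBlocks : ∀ j → 0 < toℕ j × toℕ j < m' → Q.partner (inj₁ i) ≡ inj₁ j → toℕ j ≡ ρ (toℕ i)
        sameBlocks j (0<j , j<m) eq with toℕ j in ej
        ... | suc j' = trans (to (blocksP i' j' (inRow (s≤s j<m))) (from (sameBlock i' j' (inRow (s≤s i<m)) (inRow (s≤s j<m))) blockQ))
                             (cong ρ (sym ei))
          where
          blockQ : IsBlock2 q (ptAt (lowerRow m') (suc i')) (ptAt (lowerRow m') (suc j'))
          blockQ = subst₂ (IsBlock2 q) (sym (ptAt-lowerRow m' i ei)) (sym (ptAt-lowerRow m' j ej)) (from (QF.block⇔partner (inj₁ i) (inj₁ j)) (sym eq))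
        byCases : (Σ (ρ (toℕ i) < suc m') λ p → partnerB (inj₁ i) ≡ inj₁ (fromℕ< p)) ⊎ (suc m' ≤ ρ (toℕ i) × partnerB (inj₁ i) ≡ inj₂ i) →
                  ∀ z → Q.partner (inj₁ i) ≡ z → Q.partner (inj₁ i) ≡ partnerB (inj₁ i)
        byCases (inj₁ (p , e)) (inj₁ j) eq =
          trans eq (from (lowerPartner⇔ i j) (sameBlocks j (notEnd i j 0<i (subst (_< m') (sym ei) i<m) eq) eq))
        byCases (inj₁ (p , e)) (inj₂ j) eq =
          ⊥-elim (NP.<⇒≱ p (subst (_≤ ρ (toℕ i)) eL (from (outside i i' ei i<m) (subst (λ z → m' < posℕ z) (sym eq) (NP.<-≤-trans m'<L' (posℕ-upper j))))))
        byCases (inj₂ (le , e)) (inj₁ j) eq =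
          ⊥-elim (NP.<⇒≱ (subst (λ z → m' < posℕ z) eq (to (outside i i' ei i<m) (subst (_≤ ρ (toℕ i)) (sym eL) le))) (ℕ.s≤s⁻¹ (FP.toℕ<n j)))
        byCases (inj₂ (le , e)) (inj₂ j) eq =
          trans (throughString i j (subst (rel q (inj₁ i)) eq (QF.rel-partner (inj₁ i)))) (sym e)

      -- the last lower point: the partner of the first one
      partnerQ-last : ∀ i → toℕ i ≡ m' → Q.partner (inj₁ i) ≡ partnerB (inj₁ i)
      partnerQ-last i im = begin
        Q.partner (inj₁ i)                  ≡⟨ cong Q.partner isLast ⟩
        Q.partner (Q.partner (inj₁ zero))   ≡⟨ Q.partner-involutive (inj₁ zero) ⟩
        inj₁ zero                           ≡⟨ partnerB-involutive (inj₁ zero) ⟨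
        partnerB (partnerB (inj₁ zero))     ≡⟨ cong partnerB (trans (partnerB-first M' ρ0') (sym firstQ)) ⟩
        partnerB (Q.partner (inj₁ zero))    ≡⟨ cong partnerB isLast ⟨
        partnerB (inj₁ i)                   ∎
        where
        open ≡-Reasoning
        isLast : inj₁ i ≡ Q.partner (inj₁ zero)
        isLast = trans (cong inj₁ (FP.toℕ-injective (trans im (sym (FP.toℕ-fromℕ m'))))) (sym firstQ)

      partnerQ-lower : ∀ i → Q.partner (inj₁ i) ≡ partnerB (inj₁ i)
      partnerQ-lower i = byIndex (toℕ i) refl
        where
        byIndex : ∀ t → toℕ i ≡ t → Q.partner (inj₁ i) ≡ partnerB (inj₁ i)
        byIndex zero ei = subst (λ z → Q.partner (inj₁ z) ≡ partnerB (inj₁ z)) (sym (FP.toℕ-injective {j = zero} ei))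
                                (trans firstQ (sym (partnerB-first M' ρ0')))
        byIndex (suc i') ei with suc i' ℕ.<? m'
        ... | yes i<m = partnerQ-interior i i' ei i<m
        ... | no i≮m = partnerQ-last i (trans ei (NP.≤-antisym (ℕ.s≤s⁻¹ (subst (_< suc m') ei (FP.toℕ<n i))) (NP.≮⇒≥ i≮m)))

      -- upper points: q = q* mirrors the lower partners
      partnerQ : ∀ x → Q.partner x ≡ partnerB x
      partnerQ (inj₁ i) = partnerQ-lower i
      partnerQ (inj₂ i) = begin
        Q.partner (inj₂ i)               ≡⟨ QF.related-partner (inj₂ i) mirror related (λ e → Q.partner≢ (inj₁ i) (unswap e)) ⟨
        swap (Q.partner (inj₁ i))        ≡⟨ cong swap (partnerQ-lower i) ⟩
        swap (partnerB (inj₁ i))         ≡⟨ partnerB-swap (inj₁ i) ⟨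
        partnerB (inj₂ i)                ∎
        where
        open ≡-Reasoning
        mirror : Pt (suc m') (suc m')
        mirror = swap (Q.partner (inj₁ i))
        unswap : mirror ≡ inj₂ i → Q.partner (inj₁ i) ≡ inj₁ i
        unswap e = trans (sym (SP.swap-involutive _)) (cong swap e)
        related : rel q (inj₂ i) mirror
        related = from (selfAdjoint (inj₂ i) mirror) (subst (rel q (inj₁ i)) (sym (SP.swap-involutive _)) (QF.rel-partner (inj₁ i)))

      q≈Br : q ≈ₚ Br M'
      q≈Br x y = ⇔.trans (Q.rel⇔partner x y) (mk⇔ (Sum.map₂ (λ e → trans e (partnerQ x))) (Sum.map₂ (λ e → trans e (sym (partnerQ x)))))

      memberQ : ⟨ p₀ ⟩ q
      memberQ = resp (≈ₚ-sym {p = q} {q = Br M'} q≈Br) (member M' colours)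

  bracketOfSector : Σ ℕ λ m → Σ (Vec Col (suc m)) λ M → Σ (Part M M) λ q →
                      IsBracket q × SecEquiv p₀ S q (lowerRow m) × ⟨ p₀ ⟩ q
  bracketOfSector = m , Mₛ , Br Mₛ , isBracketBr Mₛ C colours (λ d _ _ → C-ρ d) ρ0' , equivalent Mₛ colours , member Mₛ colours
    where
    open OfLength m L≡
    Mₛ : Vec Col (suc m)
    Mₛ = tabulate (λ i → C (toℕ i))
    colours : ∀ i → lookup Mₛ i ≡ C (toℕ i)
    colours = VP.lookup∘tabulate (λ i → C (toℕ i))

  bracketsOfSector : ∀ {m} {M : Vec Col (suc m)} (q : Part M M) → IsBracket q → SecEquiv p₀ S q (lowerRow m) → ⟨ p₀ ⟩ q
  bracketsOfSector {m'} q isB se = OfLength.Unique.memberQ m' (SecEquiv.sameSize se) q isB se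

lemma6p4 : ∀ {k l} {lo : Vec Col k} {up : Vec Col l} (p : Part lo up) →
    P2nb p → (S : Interval (k + l)) → IsSector p S →
    (Σ ℕ λ m → Σ (Vec Col (suc m)) λ M → Σ (Part M M) λ q →
       IsBracket q × SecEquiv p S q (lowerRow m) × ⟨ p ⟩ q)
    × (∀ {m} {M : Vec Col (suc m)} (q : Part M M) →
       IsBracket q → SecEquiv p S q (lowerRow m) → ⟨ p ⟩ q)
lemma6p4 p P2 S sec = bracketOfSector , bracketsOfSector
  where open SectorCoordinates p P2 S sec
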